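{- Let $f\in t\,\mathbb{F}_q[t]$ be nonzero and let $d$ be a positive integer with $q^d\mid\delta(f)$. Then $\delta(f)$ can be uniquely written as $$\delta(f)=c_1q^{dj_1}+c_2q^{dj_2}+\dots+c_kq^{dj_k}$$ with $j_1>j_2>\dots>j_k>0$ and $1\le c_i<q^d$ for $i=1,\dots,k$. Put $b_j=\frac{q^{dj}-1}{q^d-1}$ for $j\ge1$ and $e_0=c_1b_{j_1}+\dots+c_kb_{j_k}$. Then the inverse image $S^{ -1}(f)=\{g\in\mathbb{F}_q[t]: S(g)=f\}$ contains the set $$\{P^e:\ P\in\mathbb{F}_q[t] \text{ irreducible of degree } d,\ e \text{ an integer with } e_0-(j_k-1)\le e\le e_0\}.$$ Moreover, taking the union of these sets over all positive integers $d$ with $q^d\mid\delta(f)$ gives all powers $P^e$ ($P$ irreducible, $e\ge1$) that lie in $S^{ -1}(f)$.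
   Context: Let $\mathbb{F}_q$ be a finite field with $q$ elements ($q$ a prime power). Fix an enumeration $\mathbb{F}_q=\{a_0,a_1,\dots,a_{q-1}\}$ with $a_0=0$, $a_1=1$. Every nonzero $f\in\mathbb{F}_q[t]$ of degree $m$ is uniquely written $f=a_{i_0}+a_{i_1}t+\dots+a_{i_m}t^m$ with $0\le i_j\le q-1$, $a_{i_m}\neq 0$. Put $\delta(f)=i_0+i_1q+\dots+i_mq^m$ and $\delta(0)=0$. Order $\mathbb{F}_q[t]$ by: $f>g$ iff $\delta(f)>\delta(g)$. For nonzero $f$, $f!=\prod_{g<f}(f-g)$ (product over all $g\in\mathbb{F}_q[t]$ with $g<f$), and $0!=1$. For nonzero $f$, $S(f)$ is the smallest $g$ (in this order) with $f\mid g!$; $S(0)=0$. -}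

module Defs where

open import Data.Nat using (ℕ; zero; suc; _+_; _*_; _∸_; _^_; _≤_; _<_; NonZero)
open import Data.Nat.DivMod using (_/_; _%_; m%n<n)
open import Data.Fin using (Fin; toℕ; fromℕ<; _≟_)
open import Data.List using (List; []; _∷_; map; foldr; upTo; length)
open import Data.Nat.ListAction using (sum)
open import Data.List.Relation.Unary.All using (All)
open import Data.List.Relation.Unary.Linked using (Linked)
open import Data.Product using (Σ; ∃; _×_; _,_; proj₁; proj₂)
open import Data.Sum using (_⊎_)
open import Data.Empty using (⊥)
open import Relation.Nullary using (¬_; yes; no)
open import Relation.Binary.PropositionalEquality using (_≡_; _≢_)
open import Algebra.Structures using (IsCommutativeRing)

-- The carrier
-- being Fin q *is* the fixed enumeration: a_i is the element i : Fin q.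
-- The convention a_0 = 0 and a_1 = 1 is imposed by zero-index / one-index.
record FiniteField (q : ℕ) : Set where
  field
    _+F_ _*F_ : Fin q → Fin q → Fin q
    -F_ : Fin q → Fin q
    0# 1# : Fin q
    isCommutativeRing : IsCommutativeRing _≡_ _+F_ _*F_ -F_ 0# 1#
    0≢1 : 0# ≢ 1#
    inverse : ∀ x → x ≢ 0# → ∃ λ y → x *F y ≡ 1#
    zero-index : toℕ 0# ≡ 0
    one-index : toℕ 1# ≡ 1

private
  fin⇒nonZero : ∀ {q} → Fin q → NonZero q
  fin⇒nonZero {suc q} _ = _

-- Polynomials over F_q as coefficient lists, constant coefficient first.
module Poly {q : ℕ} (F : FiniteField q) where
  open FiniteField F public

  private
    instance
      q-nonZero : NonZero q
      q-nonZero = fin⇒nonZero 0#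

  Pol : Set
  Pol = List (Fin q)

  strip : Pol → Pol
  strip [] = []
  strip (a ∷ as) with strip as
  ... | b ∷ bs = a ∷ b ∷ bs
  ... | [] with a ≟ 0#
  ...   | yes _ = []
  ...   | no _ = a ∷ []

  Normalized : Pol → Set
  Normalized p = strip p ≡ p

  -- degree of a normalized nonzero polynomial
  deg : Pol → ℕ
  deg p = length p ∸ 1

  addRaw : Pol → Pol → Pol
  addRaw [] ys = ys
  addRaw (x ∷ xs) [] = x ∷ xs
  addRaw (x ∷ xs) (y ∷ ys) = (x +F y) ∷ addRaw xs ys

  mulRaw : Pol → Pol → Pol
  mulRaw [] ys = []
  mulRaw (x ∷ xs) ys = addRaw (map (x *F_) ys) (0# ∷ mulRaw xs ys)

  _+ₚ_ : Pol → Pol → Pol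
  p +ₚ r = strip (addRaw p r)

  _*ₚ_ : Pol → Pol → Pol
  p *ₚ r = strip (mulRaw p r)

  _-ₚ_ : Pol → Pol → Pol
  p -ₚ r = strip (addRaw p (map -F_ r))

  1ₚ : Pol
  1ₚ = 1# ∷ []

  _^ₚ_ : Pol → ℕ → Pol
  p ^ₚ zero = 1ₚ
  p ^ₚ suc e = p *ₚ (p ^ₚ e)

  _∣ₚ_ : Pol → Pol → Set
  p ∣ₚ r = ∃ λ h → p *ₚ h ≡ strip r

  Irreducible : Pol → Set
  Irreducible P = Normalized P × 1 Data.Nat.≤ deg P ×
    (∀ a b → a *ₚ b ≡ P → length (strip a) ≡ 1 ⊎ length (strip b) ≡ 1)

  -- δ(a_{i_0} + a_{i_1} t + … ) = i_0 + i_1 q + …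
  δ : Pol → ℕ
  δ = foldr (λ a acc → toℕ a + q * acc) 0

  -- inverse of δ on normalized polynomials: base-q digits (fuel = n)
  decodeFuel : ℕ → ℕ → Pol
  decodeFuel zero _ = []
  decodeFuel (suc k) zero = []
  decodeFuel (suc k) (suc n) =
    fromℕ< (m%n<n (suc n) q) ∷ decodeFuel k (suc n / q)

  decode : ℕ → Pol
  decode n = decodeFuel n n

  -- f! = ∏_{g < f} (f - g); the g < f are exactly decode n for n < δ f
  fact : Pol → Pol
  fact f = foldr _*ₚ_ 1ₚ (map (λ n → f -ₚ decode n) (upTo (δ f)))

  -- "S(g) = h": S(0) = 0, and for g ≠ 0, h is the smallest polynomial
  -- (w.r.t. the δ-order) with g ∣ h!
  SIs : Pol → Pol → Set
  SIs g h = (g ≡ [] × h ≡ []) ⊎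
    (g ≢ [] × Normalized h × g ∣ₚ fact h ×
      (∀ h' → Normalized h' → δ h' < δ h → ¬ (g ∣ₚ fact h')))

  -- representations n = c_1 q^{d j_1} + … + c_k q^{d j_k}, as a list of
  -- pairs (c_i , j_i) with j_1 > … > j_k > 0 and 1 ≤ c_i < q^d
  repSum : ℕ → List (ℕ × ℕ) → ℕ
  repSum d [] = 0
  repSum d ((c , j) ∷ r) = c * q ^ (d * j) + repSum d r

  IsRep : ℕ → ℕ → List (ℕ × ℕ) → Set
  IsRep d n cs = repSum d cs ≡ n ×
    Linked (λ x y → proj₂ y < proj₂ x) cs ×
    All (λ x → 0 < proj₂ x × 1 Data.Nat.≤ proj₁ x × proj₁ x < q ^ d) cs

  -- b_j = (q^{dj} - 1)/(q^d - 1) = 1 + q^d + … + q^{d(j-1)}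
  b : ℕ → ℕ → ℕ
  b d j = sum (map (λ i → q ^ (d * i)) (upTo j))

  e₀ : ℕ → List (ℕ × ℕ) → ℕ
  e₀ d cs = sum (map (λ x → proj₁ x * b d (proj₂ x)) cs)

  lastJ : List (ℕ × ℕ) → ℕ
  lastJ [] = 0
  lastJ (x ∷ []) = proj₂ x
  lastJ (_ ∷ y ∷ r) = lastJ (y ∷ r)

{-# OPTIONS --safe #-}
module Submission where

-- Fix an irreducible P of degree d.  The P-adic valuation of h! obeys a
-- Legendre formula  v_P(h!) = Σ_{k ≥ 1} ⌊δ(h) / q^{dk}⌋ :  the codes
-- g = 0, 1, …, δ(h) - 1 split into blocks of q^{dk} consecutive codes whose
-- polynomials run through all residues modulo P^k, so every complete block
-- contains exactly one g with P^k ∣ h - g, and the final partial block none.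
-- Writing T(n) for the Legendre sum, P^e ∣ h! iff e ≤ T(δ h), and T is
-- monotone; hence S(P^e) = f iff T(δ f - 1) < e ≤ T(δ f).  On the base-q^d
-- expansion δ f = Σ c_i q^{d j_i} one computes T(δ f) = e₀ and
-- T(δ f - 1) = e₀ - j_k, while T(δ f - 1) = T(δ f) when q^d ∤ δ f.

open import Defs
open import Data.Nat as ℕ
  using (ℕ; zero; suc; _+_; _*_; _∸_; _^_; _≤_; _<_; _≤?_; _<?_; z≤n; s≤s; NonZero; _/_; _%_)
import Data.Nat.Properties as ℕₚ
import Data.Nat.DivMod as DivMod
open import Data.Nat.Divisibility using (_∣_; _∣?_; divides; divides-refl; ∣-trans; m%n≡0⇒n∣m)
open import Data.Nat.Solver using (module +-*-Solver)
open import Data.Fin using (Fin; toℕ; fromℕ<; _≟_)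
import Data.Fin.Properties as Finₚ
open import Data.List using (List; []; _∷_; map; foldr; length; _++_; applyUpTo)
open import Data.Nat.ListAction using (sum)
open import Data.List.Relation.Unary.All as All using (All; []; _∷_)
import Data.List.Relation.Unary.All.Properties as Allₚ
open import Data.List.Relation.Unary.Linked as Linked using (Linked; []; [-]; _∷_)
open import Data.Product using (∃; ∃₂; _×_; _,_; proj₁; proj₂)
open import Data.Sum using (_⊎_; inj₁; inj₂)
open import Data.Empty using (⊥; ⊥-elim)
open import Relation.Nullary using (¬_; yes; no; Dec)
open import Relation.Binary.Definitions using (tri<; tri≈; tri>)
open import Relation.Binary.PropositionalEquality
open import Algebra.Bundles using (CommutativeRing)
import Algebra.Properties.Ring as RingProperties
import Algebra.Properties.Group as GroupProperties
import Algebra.Properties.AbelianGroup as AbelianGroupProperties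
import Algebra.Solver.Ring.NaturalCoefficients.Default as NaturalCoefficientSolver
open import Level using (0ℓ)
import Relation.Binary.Reasoning.Setoid as SetoidReasoning

-- Finite sums

sumTo : ℕ → (ℕ → ℕ) → ℕ
sumTo zero g = 0
sumTo (suc n) g = g 0 + sumTo n (λ i → g (suc i))

sumTo-cong : ∀ n {g g' : ℕ → ℕ} → (∀ i → i < n → g i ≡ g' i) → sumTo n g ≡ sumTo n g'
sumTo-cong zero h = refl
sumTo-cong (suc n) h = cong₂ _+_ (h 0 (s≤s z≤n)) (sumTo-cong n (λ i lt → h (suc i) (s≤s lt)))

sumTo-+ : ∀ m n g → sumTo (m + n) g ≡ sumTo m g + sumTo n (λ r → g (m + r))
sumTo-+ zero n g = refl
sumTo-+ (suc m) n g =
  trans (cong (g 0 +_) (sumTo-+ m n (λ i → g (suc i)))) (sym (ℕₚ.+-assoc (g 0) _ _))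

sumTo-* : ∀ m n g → sumTo (m * n) g ≡ sumTo m (λ j → sumTo n (λ r → g (j * n + r)))
sumTo-* zero n g = refl
sumTo-* (suc m) n g = trans (sumTo-+ n (m * n) g) (cong (sumTo n g +_)
  (trans (sumTo-* m n (λ r → g (n + r)))
    (sumTo-cong m λ j _ → sumTo-cong n λ r _ → cong g (sym (ℕₚ.+-assoc n (j * n) r)))))

sumTo-const : ∀ n c → sumTo n (λ _ → c) ≡ n * c
sumTo-const zero c = refl
sumTo-const (suc n) c = cong (c +_) (sumTo-const n c)

sumTo-zeros : ∀ n {g} → (∀ i → i < n → g i ≡ 0) → sumTo n g ≡ 0
sumTo-zeros n h = trans (sumTo-cong n h) (trans (sumTo-const n 0) (ℕₚ.*-zeroʳ n))

sumTo-single : ∀ n {g} i₀ → i₀ < n → g i₀ ≡ 1 → (∀ i → i < n → i ≢ i₀ → g i ≡ 0) → sumTo n g ≡ 1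
sumTo-single n {g} i₀ i₀<n gi₀≡1 others = begin
  sumTo n g                                                 ≡⟨ cong (λ z → sumTo z g) (sym n≡) ⟩
  sumTo (i₀ + suc t) g                                      ≡⟨ sumTo-+ i₀ (suc t) g ⟩
  sumTo i₀ g + (g (i₀ + 0) + sumTo t (λ r → g (i₀ + suc r))) ≡⟨ cong₂ _+_ below (cong₂ _+_ at above) ⟩
  1 ∎
  where
  open ≡-Reasoning
  t = n ∸ suc i₀
  n≡ : i₀ + suc t ≡ n
  n≡ = trans (ℕₚ.+-suc i₀ t) (ℕₚ.m+[n∸m]≡n i₀<n)
  below : sumTo i₀ g ≡ 0
  below = sumTo-zeros i₀ λ i i<i₀ → others i (ℕₚ.<-trans i<i₀ i₀<n) (ℕₚ.<⇒≢ i<i₀)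
  at : g (i₀ + 0) ≡ 1
  at = trans (cong g (ℕₚ.+-identityʳ i₀)) gi₀≡1
  above : sumTo t (λ r → g (i₀ + suc r)) ≡ 0
  above = sumTo-zeros t λ r r<t → others (i₀ + suc r)
    (subst (i₀ + suc r <_) n≡ (ℕₚ.+-monoʳ-< i₀ (s≤s r<t)))
    (ℕₚ.>⇒≢ (subst (i₀ <_) (sym (ℕₚ.+-suc i₀ r)) (s≤s (ℕₚ.m≤m+n i₀ r))))

sumTo-distrib : ∀ n f g → sumTo n (λ i → f i + g i) ≡ sumTo n f + sumTo n g
sumTo-distrib zero f g = refl
sumTo-distrib (suc n) f g = trans (cong (f 0 + g 0 +_) (sumTo-distrib n _ _))
  (interchange (f 0) (g 0) (sumTo n _) (sumTo n _))
  where
  open +-*-Solver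
  interchange : ∀ a b c d → a + b + (c + d) ≡ a + c + (b + d)
  interchange = solve 4 (λ a b c d → a :+ b :+ (c :+ d) := a :+ c :+ (b :+ d)) refl

sumTo-swap : ∀ m n (g : ℕ → ℕ → ℕ) →
  sumTo m (λ i → sumTo n (λ k → g i k)) ≡ sumTo n (λ k → sumTo m (λ i → g i k))
sumTo-swap zero n g = sym (sumTo-zeros n λ _ _ → refl)
sumTo-swap (suc m) n g =
  trans (cong (sumTo n (g 0) +_) (sumTo-swap m n (λ i → g (suc i)))) (sym (sumTo-distrib n (g 0) _))

sumTo-mono-≤ : ∀ n {f g} → (∀ i → i < n → f i ≤ g i) → sumTo n f ≤ sumTo n g
sumTo-mono-≤ zero h = z≤n
sumTo-mono-≤ (suc n) h = ℕₚ.+-mono-≤ (h 0 (s≤s z≤n)) (sumTo-mono-≤ n (λ i lt → h (suc i) (s≤s lt)))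

sumTo-*ˡ : ∀ n c g → sumTo n (λ i → c * g i) ≡ c * sumTo n g
sumTo-*ˡ zero c g = sym (ℕₚ.*-zeroʳ c)
sumTo-*ˡ (suc n) c g = trans (cong (c * g 0 +_) (sumTo-*ˡ n c _)) (sym (ℕₚ.*-distribˡ-+ c (g 0) _))

sumTo-suc : ∀ n g → sumTo (suc n) g ≡ sumTo n g + g n
sumTo-suc n g = trans (cong (λ z → sumTo z g) (ℕₚ.+-comm 1 n)) (trans (sumTo-+ n 1 g)
  (cong (sumTo n g +_) (trans (ℕₚ.+-identityʳ _) (cong g (ℕₚ.+-identityʳ n)))))

sumTo-reverse : ∀ n g → sumTo n (λ k → g (n ∸ suc k)) ≡ sumTo n g
sumTo-reverse zero g = refl
sumTo-reverse (suc n) g =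
  trans (cong (g n +_) (sumTo-reverse n g)) (trans (ℕₚ.+-comm (g n) _) (sym (sumTo-suc n g)))

sum-map-applyUpTo : ∀ (g : ℕ → ℕ) f n → sum (map g (applyUpTo f n)) ≡ sumTo n (λ i → g (f i))
sum-map-applyUpTo g f zero = refl
sum-map-applyUpTo g f (suc n) = cong (g (f 0) +_) (sum-map-applyUpTo g (λ i → f (suc i)) n)

indicator : ∀ {A : Set} → Dec A → ℕ
indicator (yes _) = 1
indicator (no _) = 0

indicator-cong : ∀ {A B : Set} → (A → B) → (B → A) → (a? : Dec A) (b? : Dec B) → indicator a? ≡ indicator b?
indicator-cong f g (yes a) (yes b) = refl
indicator-cong f g (yes a) (no ¬b) = ⊥-elim (¬b (f a))
indicator-cong f g (no ¬a) (yes b) = ⊥-elim (¬a (g b))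
indicator-cong f g (no ¬a) (no ¬b) = refl

indicator-yes : ∀ {A : Set} (a? : Dec A) → A → indicator a? ≡ 1
indicator-yes (yes _) _ = refl
indicator-yes (no ¬a) a = ⊥-elim (¬a a)

indicator-no : ∀ {A : Set} (a? : Dec A) → ¬ A → indicator a? ≡ 0
indicator-no (yes a) ¬a = ⊥-elim (¬a a)
indicator-no (no _) _ = refl

sumTo-indicator-< : ∀ v K → v ≤ K → sumTo K (λ k → indicator (suc k ≤? v)) ≡ v
sumTo-indicator-< v K v≤K = begin
  sumTo K g                                   ≡⟨ cong (λ z → sumTo z g) (sym (ℕₚ.m+[n∸m]≡n v≤K)) ⟩
  sumTo (v + (K ∸ v)) g                       ≡⟨ sumTo-+ v (K ∸ v) g ⟩
  sumTo v g + sumTo (K ∸ v) (λ r → g (v + r)) ≡⟨ cong₂ _+_ ones zeros ⟩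
  v + 0                                       ≡⟨ ℕₚ.+-identityʳ v ⟩
  v ∎
  where
  open ≡-Reasoning
  g : ℕ → ℕ
  g k = indicator (suc k ≤? v)
  ones : sumTo v g ≡ v
  ones = trans (sumTo-cong v (λ i i<v → indicator-yes (suc i ≤? v) i<v))
    (trans (sumTo-const v 1) (ℕₚ.*-identityʳ v))
  zeros : sumTo (K ∸ v) (λ r → g (v + r)) ≡ 0
  zeros = sumTo-zeros (K ∸ v) λ r _ → indicator-no (suc (v + r) ≤? v)
    (λ le → ℕₚ.<-irrefl refl (ℕₚ.≤-trans (s≤s (ℕₚ.m≤m+n v r)) le))

-- Polynomials up to trailing zeros

module PolynomialRing {q : ℕ} (F : FiniteField q) where
  open Poly F public

  fieldRing : CommutativeRing 0ℓ 0ℓ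
  fieldRing = record { isCommutativeRing = isCommutativeRing }

  module 𝔽 where
    open CommutativeRing fieldRing public hiding (refl; sym; trans; 0#; 1#; _+_; _*_; -_)
    open RingProperties ring public using (-‿distribˡ-*)
    open AbelianGroupProperties +-abelianGroup public using (⁻¹-∙-comm)

  -0#≡0# : -F 0# ≡ 0#
  -0#≡0# = trans (sym (𝔽.+-identityˡ (-F 0#))) (𝔽.-‿inverseʳ 0#)

  open NaturalCoefficientSolver 𝔽.commutativeSemiring using (solve; _:+_; _:*_; _:=_)

  coeff : Pol → ℕ → Fin q
  coeff [] i = 0#
  coeff (a ∷ as) zero = a
  coeff (a ∷ as) (suc i) = coeff as i

  infix 4 _≈_
  record _≈_ (a b : Pol) : Set where
    constructor mk≈
    field coeff≡ : ∀ i → coeff a i ≡ coeff b i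
  open _≈_ public

  ≈-refl : ∀ {a} → a ≈ a
  ≈-refl = mk≈ λ i → refl

  ≈-sym : ∀ {a b} → a ≈ b → b ≈ a
  ≈-sym e = mk≈ λ i → sym (coeff≡ e i)

  ≈-trans : ∀ {a b c} → a ≈ b → b ≈ c → a ≈ c
  ≈-trans e f = mk≈ λ i → trans (coeff≡ e i) (coeff≡ f i)

  ≈-reflexive : ∀ {a b} → a ≡ b → a ≈ b
  ≈-reflexive refl = ≈-refl

  ∷-cong : ∀ {x y a b} → x ≡ y → a ≈ b → (x ∷ a) ≈ (y ∷ b)
  ∷-cong e f = mk≈ λ { zero → e ; (suc i) → coeff≡ f i }

  ≈-tail : ∀ {a b as bs} → (a ∷ as) ≈ (b ∷ bs) → as ≈ bs
  ≈-tail e = mk≈ λ i → coeff≡ e (suc i)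

  ≈[]-tail : ∀ {a as} → (a ∷ as) ≈ [] → as ≈ []
  ≈[]-tail e = mk≈ λ i → coeff≡ e (suc i)

  coeff-strip : ∀ a i → coeff (strip a) i ≡ coeff a i
  coeff-strip [] i = refl
  coeff-strip (a ∷ as) i with strip as | coeff-strip as
  ... | b ∷ bs | ih with i
  ...   | zero = refl
  ...   | suc i = ih i
  coeff-strip (a ∷ as) i | [] | ih with a ≟ 0#
  ...   | yes a≡0 with i
  ...     | zero = sym a≡0
  ...     | suc i = ih i
  coeff-strip (a ∷ as) i | [] | ih | no _ with i
  ...     | zero = refl
  ...     | suc i = ih i

  stripCons : Fin q → Pol → Pol
  stripCons a (b ∷ bs) = a ∷ b ∷ bs
  stripCons a [] with a ≟ 0#
  ... | yes _ = []
  ... | no _ = a ∷ []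

  strip-∷ : ∀ a as → strip (a ∷ as) ≡ stripCons a (strip as)
  strip-∷ a as with strip as
  ... | b ∷ bs = refl
  ... | [] with a ≟ 0#
  ...   | yes _ = refl
  ...   | no _ = refl

  stripCons-0# : stripCons 0# [] ≡ []
  stripCons-0# with 0# ≟ 0#
  ... | yes _ = refl
  ... | no 0≢0 = ⊥-elim (0≢0 refl)

  strip-≈[] : ∀ a → a ≈ [] → strip a ≡ []
  strip-≈[] [] e = refl
  strip-≈[] (a ∷ as) e = trans (strip-∷ a as)
    (trans (cong₂ stripCons (coeff≡ e 0) (strip-≈[] as (≈[]-tail e))) stripCons-0#)

  ≈⇒strip≡ : ∀ a b → a ≈ b → strip a ≡ strip b
  ≈⇒strip≡ [] [] e = refl
  ≈⇒strip≡ (a ∷ as) (b ∷ bs) e = trans (strip-∷ a as)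
    (trans (cong₂ stripCons (coeff≡ e 0) (≈⇒strip≡ as bs (≈-tail e))) (sym (strip-∷ b bs)))
  ≈⇒strip≡ (a ∷ as) [] e = strip-≈[] (a ∷ as) e
  ≈⇒strip≡ [] (b ∷ bs) e = sym (strip-≈[] (b ∷ bs) (≈-sym e))

  strip≡⇒≈ : ∀ a b → strip a ≡ strip b → a ≈ b
  strip≡⇒≈ a b e = mk≈ λ i →
    trans (sym (coeff-strip a i)) (trans (cong (λ z → coeff z i) e) (coeff-strip b i))

  strip-≈ : ∀ a → strip a ≈ a
  strip-≈ a = mk≈ (coeff-strip a)

  strip-idem : ∀ a → strip (strip a) ≡ strip a
  strip-idem a = ≈⇒strip≡ _ _ (strip-≈ a)

  scale : Fin q → Pol → Pol
  scale x = map (x *F_)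

  neg : Pol → Pol
  neg = map -F_

  coeff-add : ∀ a b i → coeff (addRaw a b) i ≡ coeff a i +F coeff b i
  coeff-add [] b i = sym (𝔽.+-identityˡ _)
  coeff-add (x ∷ xs) [] i = sym (𝔽.+-identityʳ _)
  coeff-add (x ∷ xs) (y ∷ ys) zero = refl
  coeff-add (x ∷ xs) (y ∷ ys) (suc i) = coeff-add xs ys i

  coeff-map : ∀ (g : Fin q → Fin q) → g 0# ≡ 0# → ∀ a i → coeff (map g a) i ≡ g (coeff a i)
  coeff-map g g0 [] i = sym g0
  coeff-map g g0 (x ∷ a) zero = refl
  coeff-map g g0 (x ∷ a) (suc i) = coeff-map g g0 a i

  coeff-scale : ∀ x a i → coeff (scale x a) i ≡ x *F coeff a i
  coeff-scale x = coeff-map (x *F_) (𝔽.zeroʳ x)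

  coeff-neg : ∀ a i → coeff (neg a) i ≡ -F coeff a i
  coeff-neg = coeff-map -F_ -0#≡0#

  coeff-mul-∷ : ∀ x xs ys i → coeff (mulRaw (x ∷ xs) ys) i ≡ (x *F coeff ys i) +F coeff (0# ∷ mulRaw xs ys) i
  coeff-mul-∷ x xs ys i = trans (coeff-add (scale x ys) _ i) (cong (_+F _) (coeff-scale x ys i))

  coeff-shift-add : ∀ a b i → coeff (0# ∷ addRaw a b) i ≡ coeff (0# ∷ a) i +F coeff (0# ∷ b) i
  coeff-shift-add a b zero = sym (𝔽.+-identityʳ 0#)
  coeff-shift-add a b (suc i) = coeff-add a b i

  coeff-shift-scale : ∀ x a i → coeff (0# ∷ scale x a) i ≡ x *F coeff (0# ∷ a) i
  coeff-shift-scale x a zero = sym (𝔽.zeroʳ x)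
  coeff-shift-scale x a (suc i) = coeff-scale x a i

  add-cong : ∀ {a a' b b'} → a ≈ a' → b ≈ b' → addRaw a b ≈ addRaw a' b'
  add-cong {a} {a'} {b} {b'} e f = mk≈ λ i →
    trans (coeff-add a b i) (trans (cong₂ _+F_ (coeff≡ e i) (coeff≡ f i)) (sym (coeff-add a' b' i)))

  neg-cong : ∀ {a b} → a ≈ b → neg a ≈ neg b
  neg-cong {a} {b} e = mk≈ λ i →
    trans (coeff-neg a i) (trans (cong -F_ (coeff≡ e i)) (sym (coeff-neg b i)))

  scale-cong : ∀ x {a b} → a ≈ b → scale x a ≈ scale x b
  scale-cong x {a} {b} e = mk≈ λ i →
    trans (coeff-scale x a i) (trans (cong (x *F_) (coeff≡ e i)) (sym (coeff-scale x b i)))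

  shift-cong : ∀ {a b} → a ≈ b → (0# ∷ a) ≈ (0# ∷ b)
  shift-cong = ∷-cong refl

  shift-≈[] : ∀ {a} → a ≈ [] → (0# ∷ a) ≈ []
  shift-≈[] e = mk≈ λ { zero → refl ; (suc i) → coeff≡ e i }

  mul-congʳ : ∀ xs {ys ys'} → ys ≈ ys' → mulRaw xs ys ≈ mulRaw xs ys'
  mul-congʳ [] e = ≈-refl
  mul-congʳ (x ∷ xs) {ys} {ys'} e = mk≈ λ i → trans (coeff-mul-∷ x xs ys i)
    (trans (cong₂ _+F_ (cong (x *F_) (coeff≡ e i)) (coeff≡ (shift-cong (mul-congʳ xs e)) i))
      (sym (coeff-mul-∷ x xs ys' i)))

  mul-zeroˡ : ∀ xs ys → xs ≈ [] → mulRaw xs ys ≈ []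
  mul-zeroˡ [] ys e = ≈-refl
  mul-zeroˡ (x ∷ xs) ys e = mk≈ λ i → trans (coeff-mul-∷ x xs ys i)
    (trans (cong₂ (λ z w → (z *F coeff ys i) +F w) (coeff≡ e 0) (coeff≡ (shift-≈[] (mul-zeroˡ xs ys (≈[]-tail e))) i))
      (trans (𝔽.+-identityʳ _) (𝔽.zeroˡ _)))

  mul-congˡ : ∀ {xs xs'} ys → xs ≈ xs' → mulRaw xs ys ≈ mulRaw xs' ys
  mul-congˡ {[]} {[]} ys e = ≈-refl
  mul-congˡ {[]} {x' ∷ xs'} ys e = ≈-sym (mul-zeroˡ (x' ∷ xs') ys (≈-sym e))
  mul-congˡ {x ∷ xs} {[]} ys e = mul-zeroˡ (x ∷ xs) ys e
  mul-congˡ {x ∷ xs} {x' ∷ xs'} ys e = mk≈ λ i → trans (coeff-mul-∷ x xs ys i)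
    (trans (cong₂ _+F_ (cong (_*F coeff ys i) (coeff≡ e 0)) (coeff≡ (shift-cong (mul-congˡ ys (≈-tail e))) i))
      (sym (coeff-mul-∷ x' xs' ys i)))

  mul-cong : ∀ {a a' b b'} → a ≈ a' → b ≈ b' → mulRaw a b ≈ mulRaw a' b'
  mul-cong {a} {a'} {b} {b'} e f = ≈-trans (mul-congˡ b e) (mul-congʳ a' f)

  add-comm : ∀ a b → addRaw a b ≈ addRaw b a
  add-comm a b = mk≈ λ i → trans (coeff-add a b i) (trans (𝔽.+-comm _ _) (sym (coeff-add b a i)))

  add-assoc : ∀ a b c → addRaw (addRaw a b) c ≈ addRaw a (addRaw b c)
  add-assoc a b c = mk≈ λ i → trans (coeff-add (addRaw a b) c i)
    (trans (cong (_+F coeff c i) (coeff-add a b i)) (trans (𝔽.+-assoc _ _ _)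
      (trans (cong (coeff a i +F_) (sym (coeff-add b c i))) (sym (coeff-add a (addRaw b c) i)))))

  add-identityʳ : ∀ a → addRaw a [] ≈ a
  add-identityʳ a = mk≈ λ i → trans (coeff-add a [] i) (𝔽.+-identityʳ _)

  add-inverseʳ : ∀ a → addRaw a (neg a) ≈ []
  add-inverseʳ a = mk≈ λ i → trans (coeff-add a (neg a) i)
    (trans (cong (coeff a i +F_) (coeff-neg a i)) (𝔽.-‿inverseʳ _))

  mul-distribˡ : ∀ xs ys zs → mulRaw xs (addRaw ys zs) ≈ addRaw (mulRaw xs ys) (mulRaw xs zs)
  mul-distribˡ [] ys zs = ≈-refl
  mul-distribˡ (x ∷ xs) ys zs = mk≈ λ i →
    trans (coeff-mul-∷ x xs (addRaw ys zs) i)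
    (trans (cong₂ (λ u v → (x *F u) +F v) (coeff-add ys zs i)
             (trans (coeff≡ (shift-cong (mul-distribˡ xs ys zs)) i) (coeff-shift-add (mulRaw xs ys) _ i)))
    (trans (solve 5 (λ x y z a b → (x :* (y :+ z)) :+ (a :+ b) := ((x :* y) :+ a) :+ ((x :* z) :+ b)) refl _ _ _ _ _)
    (sym (trans (coeff-add (mulRaw (x ∷ xs) ys) _ i) (cong₂ _+F_ (coeff-mul-∷ x xs ys i) (coeff-mul-∷ x xs zs i))))))

  mul-distribʳ : ∀ xs xs' ys → mulRaw (addRaw xs xs') ys ≈ addRaw (mulRaw xs ys) (mulRaw xs' ys)
  mul-distribʳ [] xs' ys = ≈-refl
  mul-distribʳ (x ∷ xs) [] ys = ≈-sym (add-identityʳ _)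
  mul-distribʳ (x ∷ xs) (x' ∷ xs') ys = mk≈ λ i →
    trans (coeff-mul-∷ (x +F x') (addRaw xs xs') ys i)
    (trans (cong (((x +F x') *F coeff ys i) +F_)
             (trans (coeff≡ (shift-cong (mul-distribʳ xs xs' ys)) i) (coeff-shift-add (mulRaw xs ys) _ i)))
    (trans (solve 5 (λ x x' y a b → ((x :+ x') :* y) :+ (a :+ b) := ((x :* y) :+ a) :+ ((x' :* y) :+ b)) refl _ _ _ _ _)
    (sym (trans (coeff-add (mulRaw (x ∷ xs) ys) _ i) (cong₂ _+F_ (coeff-mul-∷ x xs ys i) (coeff-mul-∷ x' xs' ys i))))))

  mul-scaleˡ : ∀ a xs ys → mulRaw (scale a xs) ys ≈ scale a (mulRaw xs ys)
  mul-scaleˡ a [] ys = ≈-refl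
  mul-scaleˡ a (x ∷ xs) ys = mk≈ λ i →
    trans (coeff-mul-∷ (a *F x) (scale a xs) ys i)
    (trans (cong (((a *F x) *F coeff ys i) +F_)
             (trans (coeff≡ (shift-cong (mul-scaleˡ a xs ys)) i) (coeff-shift-scale a _ i)))
    (trans (solve 4 (λ a x y w → ((a :* x) :* y) :+ (a :* w) := a :* ((x :* y) :+ w)) refl _ _ _ _)
    (sym (trans (coeff-scale a (mulRaw (x ∷ xs) ys) i) (cong (a *F_) (coeff-mul-∷ x xs ys i))))))

  mul-scaleʳ : ∀ a xs ys → mulRaw xs (scale a ys) ≈ scale a (mulRaw xs ys)
  mul-scaleʳ a [] ys = ≈-refl
  mul-scaleʳ a (x ∷ xs) ys = mk≈ λ i →
    trans (coeff-mul-∷ x xs (scale a ys) i)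
    (trans (cong₂ (λ u v → (x *F u) +F v) (coeff-scale a ys i)
             (trans (coeff≡ (shift-cong (mul-scaleʳ a xs ys)) i) (coeff-shift-scale a _ i)))
    (trans (solve 4 (λ a x y w → (x :* (a :* y)) :+ (a :* w) := a :* ((x :* y) :+ w)) refl _ _ _ _)
    (sym (trans (coeff-scale a (mulRaw (x ∷ xs) ys) i) (cong (a *F_) (coeff-mul-∷ x xs ys i))))))

  mul-shiftˡ : ∀ xs ys → mulRaw (0# ∷ xs) ys ≈ (0# ∷ mulRaw xs ys)
  mul-shiftˡ xs ys = mk≈ λ i → trans (coeff-mul-∷ 0# xs ys i)
    (trans (cong (_+F coeff (0# ∷ mulRaw xs ys) i) (𝔽.zeroˡ _)) (𝔽.+-identityˡ _))

  mul-shiftʳ : ∀ xs ys → mulRaw xs (0# ∷ ys) ≈ (0# ∷ mulRaw xs ys)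
  mul-shiftʳ [] ys = mk≈ λ { zero → refl ; (suc i) → refl }
  mul-shiftʳ (x ∷ xs) ys = mk≈ λ
    { zero → trans (coeff-mul-∷ x xs (0# ∷ ys) 0) (trans (𝔽.+-identityʳ _) (𝔽.zeroʳ x))
    ; (suc i) → trans (coeff-mul-∷ x xs (0# ∷ ys) (suc i))
        (trans (cong ((x *F coeff ys i) +F_) (coeff≡ (mul-shiftʳ xs ys) i)) (sym (coeff-mul-∷ x xs ys i))) }

  mul-zeroʳ : ∀ xs → mulRaw xs [] ≈ []
  mul-zeroʳ [] = ≈-refl
  mul-zeroʳ (x ∷ xs) = mk≈ λ i → trans (coeff-mul-∷ x xs [] i)
    (trans (cong₂ _+F_ (𝔽.zeroʳ x) (coeff≡ (shift-≈[] (mul-zeroʳ xs)) i)) (𝔽.+-identityʳ _))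

  mul-constʳ : ∀ xs y → mulRaw xs (y ∷ []) ≈ scale y xs
  mul-constʳ [] y = ≈-refl
  mul-constʳ (x ∷ xs) y = mk≈ λ
    { zero → trans (coeff-mul-∷ x xs (y ∷ []) 0) (trans (𝔽.+-identityʳ _) (𝔽.*-comm x y))
    ; (suc i) → trans (coeff-mul-∷ x xs (y ∷ []) (suc i))
        (trans (cong₂ _+F_ (𝔽.zeroʳ x) (coeff≡ (mul-constʳ xs y) i)) (𝔽.+-identityˡ _)) }

  ∷-split : ∀ x xs → (x ∷ xs) ≈ addRaw (x ∷ []) (0# ∷ xs)
  ∷-split x xs = mk≈ λ { zero → sym (𝔽.+-identityʳ x) ; (suc i) → refl }

  mul-comm : ∀ xs ys → mulRaw xs ys ≈ mulRaw ys xs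
  mul-comm [] ys = ≈-sym (mul-zeroʳ ys)
  mul-comm (x ∷ xs) ys =
    ≈-trans (add-cong {scale x ys} ≈-refl (shift-cong (mul-comm xs ys)))
    (≈-trans (add-cong (≈-sym (mul-constʳ ys x)) (≈-sym (mul-shiftʳ ys xs)))
    (≈-trans (≈-sym (mul-distribˡ ys (x ∷ []) (0# ∷ xs))) (mul-congʳ ys (≈-sym (∷-split x xs)))))

  mul-assoc : ∀ xs ys zs → mulRaw (mulRaw xs ys) zs ≈ mulRaw xs (mulRaw ys zs)
  mul-assoc [] ys zs = ≈-refl
  mul-assoc (x ∷ xs) ys zs =
    ≈-trans (mul-distribʳ (scale x ys) (0# ∷ mulRaw xs ys) zs)
    (add-cong (mul-scaleˡ x ys zs) (≈-trans (mul-shiftˡ (mulRaw xs ys) zs) (shift-cong (mul-assoc xs ys zs))))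

  mul-identityˡ : ∀ ys → mulRaw (1# ∷ []) ys ≈ ys
  mul-identityˡ ys = ≈-trans (mul-comm _ ys)
    (≈-trans (mul-constʳ ys 1#) (mk≈ λ i → trans (coeff-scale 1# ys i) (𝔽.*-identityˡ _)))

  mul-identityʳ : ∀ a → mulRaw a (1# ∷ []) ≈ a
  mul-identityʳ a = ≈-trans (mul-comm a _) (mul-identityˡ a)

  polyRing : CommutativeRing 0ℓ 0ℓ
  polyRing = record
    { Carrier = Pol ; _≈_ = _≈_ ; _+_ = addRaw ; _*_ = mulRaw ; -_ = neg ; 0# = [] ; 1# = 1# ∷ []
    ; isCommutativeRing = record
      { isRing = record
        { +-isAbelianGroup = record
          { isGroup = record
            { isMonoid = record
              { isSemigroup = record
                { isMagma = record
                  { isEquivalence = record { refl = ≈-refl ; sym = ≈-sym ; trans = ≈-trans }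
                  ; ∙-cong = add-cong }
                ; assoc = add-assoc }
              ; identity = (λ a → ≈-refl) , add-identityʳ }
            ; inverse = (λ a → ≈-trans (add-comm (neg a) a) (add-inverseʳ a)) , add-inverseʳ
            ; ⁻¹-cong = neg-cong }
          ; comm = add-comm }
        ; *-cong = mul-cong
        ; *-assoc = mul-assoc
        ; *-identity = mul-identityˡ , mul-identityʳ
        ; distrib = mul-distribˡ , (λ x y z → mul-distribʳ y z x) }
      ; *-comm = mul-comm } }

module PolynomialDegree {q : ℕ} (F : FiniteField q) where
  open PolynomialRing F public

  len : Pol → ℕ
  len a = length (strip a)

  Nonzero : Pol → Set
  Nonzero a = ¬ (a ≈ [])

  coeff-≥length : ∀ a i → length a ≤ i → coeff a i ≡ 0#
  coeff-≥length [] i _ = refl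
  coeff-≥length (x ∷ a) (suc i) (s≤s le) = coeff-≥length a i le

  coeff-≥len : ∀ a i → len a ≤ i → coeff a i ≡ 0#
  coeff-≥len a i le = trans (sym (coeff-strip a i)) (coeff-≥length (strip a) i le)

  stripCons-leading≢0 : ∀ a s → (∀ n → length s ≡ suc n → coeff s n ≢ 0#) →
    ∀ n → length (stripCons a s) ≡ suc n → coeff (stripCons a s) n ≢ 0#
  stripCons-leading≢0 a (b ∷ bs) ih (suc n) eq = ih n (ℕₚ.suc-injective eq)
  stripCons-leading≢0 a [] ih n eq with a ≟ 0#
  stripCons-leading≢0 a [] ih n () | yes _
  stripCons-leading≢0 a [] ih zero eq | no a≢0 = a≢0

  strip-leading≢0 : ∀ a n → length (strip a) ≡ suc n → coeff (strip a) n ≢ 0#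
  strip-leading≢0 [] n ()
  strip-leading≢0 (a ∷ as) n = subst (λ s → length s ≡ suc n → coeff s n ≢ 0#) (sym (strip-∷ a as))
    (stripCons-leading≢0 a (strip as) (strip-leading≢0 as) n)

  leading≢0 : ∀ a n → len a ≡ suc n → coeff a n ≢ 0#
  leading≢0 a n eq z = strip-leading≢0 a n eq (trans (coeff-strip a n) z)

  len-≤ : ∀ a m → (∀ i → m ≤ i → coeff a i ≡ 0#) → len a ≤ m
  len-≤ a m h with len a in eq
  ... | zero = z≤n
  ... | suc n with suc n ≤? m
  ...   | yes n<m = n<m
  ...   | no n≮m = ⊥-elim (leading≢0 a n eq (h n (ℕₚ.≤-pred (ℕₚ.≰⇒> n≮m))))

  coeff≢0⇒<len : ∀ a n → coeff a n ≢ 0# → n < len a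
  coeff≢0⇒<len a n nz with n <? len a
  ... | yes n<len = n<len
  ... | no n≮len = ⊥-elim (nz (coeff-≥len a n (ℕₚ.≮⇒≥ n≮len)))

  len-cong : ∀ {a b} → a ≈ b → len a ≡ len b
  len-cong {a} {b} e = cong length (≈⇒strip≡ a b e)

  len≡0⇒≈[] : ∀ a → len a ≡ 0 → a ≈ []
  len≡0⇒≈[] a e = mk≈ λ i → coeff-≥len a i (subst (_≤ i) (sym e) z≤n)

  len≡suc⇒nonzero : ∀ a n → len a ≡ suc n → Nonzero a
  len≡suc⇒nonzero a n e z with trans (sym e) (len-cong z)
  ... | ()

  nonzero⇒len≡suc : ∀ a → Nonzero a → ∃ λ n → len a ≡ suc n
  nonzero⇒len≡suc a nz with len a in eq
  ... | zero = ⊥-elim (nz (len≡0⇒≈[] a eq))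
  ... | suc n = n , refl

  len≡1⇒const : ∀ a → len a ≡ 1 → a ≈ (coeff a 0 ∷ [])
  len≡1⇒const a e = mk≈ λ
    { zero → refl ; (suc i) → coeff-≥len a (suc i) (subst (_≤ suc i) (sym e) (s≤s z≤n)) }

  len-1# : len (1# ∷ []) ≡ 1
  len-1# = ℕₚ.≤-antisym (len-≤ (1# ∷ []) 1 λ { zero () ; (suc i) _ → refl })
    (coeff≢0⇒<len (1# ∷ []) 0 λ e → 0≢1 (sym e))

  *F-nonzero : ∀ x y → x ≢ 0# → y ≢ 0# → x *F y ≢ 0#
  *F-nonzero x y x≢0 y≢0 xy≡0 with inverse y y≢0
  ... | y⁻¹ , yy⁻¹≡1 = x≢0 (begin
      x                ≡⟨ sym (𝔽.*-identityʳ x) ⟩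
      x *F 1#          ≡⟨ cong (x *F_) (sym yy⁻¹≡1) ⟩
      x *F (y *F y⁻¹)  ≡⟨ sym (𝔽.*-assoc x y y⁻¹) ⟩
      (x *F y) *F y⁻¹  ≡⟨ cong (_*F y⁻¹) xy≡0 ⟩
      0# *F y⁻¹        ≡⟨ 𝔽.zeroˡ y⁻¹ ⟩
      0# ∎)
    where open ≡-Reasoning

  coeff-mul-top : ∀ a b n m → (∀ i → n < i → coeff a i ≡ 0#) → (∀ j → m < j → coeff b j ≡ 0#) →
    (coeff (mulRaw a b) (n + m) ≡ coeff a n *F coeff b m) × (∀ k → n + m < k → coeff (mulRaw a b) k ≡ 0#)
  coeff-mul-top [] b n m ha hb = sym (𝔽.zeroˡ _) , λ k _ → refl
  coeff-mul-top (x ∷ xs) b zero m ha hb = top , above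
    where
    rest≈[] : (0# ∷ mulRaw xs b) ≈ []
    rest≈[] = shift-≈[] (mul-zeroˡ xs b (mk≈ λ i → ha (suc i) (s≤s z≤n)))
    top : coeff (mulRaw (x ∷ xs) b) m ≡ x *F coeff b m
    top = trans (coeff-mul-∷ x xs b m) (trans (cong ((x *F coeff b m) +F_) (coeff≡ rest≈[] m)) (𝔽.+-identityʳ _))
    above : ∀ k → m < k → coeff (mulRaw (x ∷ xs) b) k ≡ 0#
    above k lt = trans (coeff-mul-∷ x xs b k)
      (trans (cong₂ (λ u v → (x *F u) +F v) (hb k lt) (coeff≡ rest≈[] k)) (trans (𝔽.+-identityʳ _) (𝔽.zeroʳ x)))
  coeff-mul-top (x ∷ xs) b (suc n) m ha hb = top , above
    where
    ih = coeff-mul-top xs b n m (λ i lt → ha (suc i) (s≤s lt)) hb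
    top : coeff (mulRaw (x ∷ xs) b) (suc (n + m)) ≡ coeff xs n *F coeff b m
    top = trans (coeff-mul-∷ x xs b (suc (n + m)))
      (trans (cong₂ (λ u v → (x *F u) +F v) (hb _ (s≤s (ℕₚ.m≤n+m m n))) (proj₁ ih))
      (trans (cong (_+F (coeff xs n *F coeff b m)) (𝔽.zeroʳ x)) (𝔽.+-identityˡ _)))
    above : ∀ k → suc (n + m) < k → coeff (mulRaw (x ∷ xs) b) k ≡ 0#
    above (suc k) (s≤s lt) = trans (coeff-mul-∷ x xs b (suc k))
      (trans (cong₂ (λ u v → (x *F u) +F v) (hb _ (ℕₚ.<-trans (s≤s (ℕₚ.m≤n+m m n)) (s≤s lt))) (proj₂ ih k lt))
      (trans (𝔽.+-identityʳ _) (𝔽.zeroʳ x)))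

  len-mul : ∀ a b n m → len a ≡ suc n → len b ≡ suc m → len (mulRaw a b) ≡ suc (n + m)
  len-mul a b n m ea eb = ℕₚ.≤-antisym
    (len-≤ (mulRaw a b) _ λ i le → proj₂ top i le)
    (coeff≢0⇒<len (mulRaw a b) _ λ z →
      *F-nonzero _ _ (leading≢0 a n ea) (leading≢0 b m eb) (trans (sym (proj₁ top)) z))
    where
    top = coeff-mul-top a b n m (λ i lt → coeff-≥len a i (subst (_≤ i) (sym ea) lt))
                                (λ j lt → coeff-≥len b j (subst (_≤ j) (sym eb) lt))

  mul-nonzero : ∀ a b → Nonzero a → Nonzero b → Nonzero (mulRaw a b)
  mul-nonzero a b a≢0 b≢0 with nonzero⇒len≡suc a a≢0 | nonzero⇒len≡suc b b≢0
  ... | n , ea | m , eb = len≡suc⇒nonzero _ _ (len-mul a b n m ea eb)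

  len-≤-mul : ∀ b h → Nonzero (mulRaw b h) → len b ≤ len (mulRaw b h)
  len-≤-mul b h nz with len b in eb | len h in eh
  ... | zero | _ = z≤n
  ... | suc n | zero = ⊥-elim (nz (≈-trans (mul-congʳ b (len≡0⇒≈[] h eh)) (mul-zeroʳ b)))
  ... | suc n | suc k = subst (suc n ≤_) (sym (len-mul b h n k eb eh)) (s≤s (ℕₚ.m≤m+n n k))

module PolynomialDivision {q : ℕ} (F : FiniteField q) where
  open PolynomialDegree F public
  open NaturalCoefficientSolver (CommutativeRing.commutativeSemiring polyRing) using (solve; _:+_; _:*_; _:=_)
  private
    module ℙ = CommutativeRing polyRing
    module ℙ-group = GroupProperties ℙ.+-group
    module ℙ-abelian = AbelianGroupProperties ℙ.+-abelianGroup

  sub : Pol → Pol → Pol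
  sub x y = addRaw x (neg y)

  sub-cong : ∀ {a a' b b'} → a ≈ a' → b ≈ b' → sub a b ≈ sub a' b'
  sub-cong e f = add-cong e (neg-cong f)

  sub-self : ∀ x → sub x x ≈ []
  sub-self = add-inverseʳ

  sub-add-cancel : ∀ a c → addRaw (sub a c) c ≈ a
  sub-add-cancel a c = ℙ-group.//-rightDividesˡ c a

  add-sub-cancelʳ : ∀ x r → sub (addRaw x r) r ≈ x
  add-sub-cancelʳ x r = ℙ-group.//-rightDividesʳ r x

  add-sub-cancelˡ : ∀ x r → sub (addRaw x r) x ≈ r
  add-sub-cancelˡ = ℙ-abelian.xyx⁻¹≈y

  sub≈[]⇒≈ : ∀ a b → sub a b ≈ [] → a ≈ b
  sub≈[]⇒≈ = ℙ-group.x∙y⁻¹≈ε⇒x≈y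

  sub-add : ∀ h s r → sub h (addRaw s r) ≈ sub (sub h s) r
  sub-add h s r = ≈-trans (add-cong ≈-refl (≈-sym (ℙ-abelian.⁻¹-∙-comm s r))) (≈-sym (add-assoc h (neg s) (neg r)))

  sub-sub-cancelˡ : ∀ c a b → sub (sub c a) (sub c b) ≈ sub b a
  sub-sub-cancelˡ c a b = begin
    sub (sub c a) (sub c b)                     ≈⟨ add-cong ≈-refl (ℙ-abelian.⁻¹-anti-homo‿- c b) ⟩
    addRaw (sub c a) (sub b c)                  ≈⟨ solve 4 (λ c -a b -c → (c :+ -a) :+ (b :+ -c) := (b :+ -a) :+ (c :+ -c)) ≈-refl c (neg a) b (neg c) ⟩
    addRaw (sub b a) (sub c c)                  ≈⟨ add-cong ≈-refl (sub-self c) ⟩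
    addRaw (sub b a) []                         ≈⟨ add-identityʳ _ ⟩
    sub b a ∎
    where open SetoidReasoning ℙ.setoid

  coeff-sub : ∀ x y i → coeff (sub x y) i ≡ coeff x i +F (-F coeff y i)
  coeff-sub x y i = trans (coeff-add x (neg y) i) (cong (coeff x i +F_) (coeff-neg y i))

  len-sub-≤ : ∀ a b D → len a ≤ D → len b ≤ D → len (sub a b) ≤ D
  len-sub-≤ a b D la lb = len-≤ (sub a b) D λ i le → trans (coeff-sub a b i)
    (trans (cong₂ (λ u v → u +F (-F v)) (coeff-≥len a i (ℕₚ.≤-trans la le)) (coeff-≥len b i (ℕₚ.≤-trans lb le)))
      (trans (cong (0# +F_) -0#≡0#) (𝔽.+-identityʳ 0#)))

  mul-negʳ : ∀ x y → mulRaw x (neg y) ≈ neg (mulRaw x y)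
  mul-negʳ x y = ℙ.sym (ℙ-ring.-‿distribʳ-* x y)
    where module ℙ-ring = RingProperties ℙ.ring

  scale-distrib : ∀ c x y → scale c (addRaw x y) ≈ addRaw (scale c x) (scale c y)
  scale-distrib c x y = mk≈ λ i → trans (coeff-scale c (addRaw x y) i)
    (trans (cong (c *F_) (coeff-add x y i)) (trans (𝔽.distribˡ c _ _)
      (sym (trans (coeff-add (scale c x) (scale c y) i) (cong₂ _+F_ (coeff-scale c x i) (coeff-scale c y i))))))

  shiftBy : ℕ → Pol → Pol
  shiftBy zero a = a
  shiftBy (suc k) a = 0# ∷ shiftBy k a

  coeff-shiftBy : ∀ k c j → coeff (shiftBy k c) (k + j) ≡ coeff c j
  coeff-shiftBy zero c j = refl
  coeff-shiftBy (suc k) c j = coeff-shiftBy k c j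

  shiftBy-cong : ∀ k {a b} → a ≈ b → shiftBy k a ≈ shiftBy k b
  shiftBy-cong zero e = e
  shiftBy-cong (suc k) e = shift-cong (shiftBy-cong k e)

  mul-shiftBy : ∀ k b c → mulRaw b (shiftBy k c) ≈ shiftBy k (mulRaw b c)
  mul-shiftBy zero b c = ≈-refl
  mul-shiftBy (suc k) b c = ≈-trans (mul-shiftʳ b (shiftBy k c)) (shift-cong (mul-shiftBy k b c))

  coeff-above-leading : ∀ a n → len a ≡ suc n → ∀ t → coeff a (n + suc t) ≡ 0#
  coeff-above-leading a n ea t = coeff-≥len a _
    (subst (_≤ n + suc t) (sym ea) (subst (suc n ≤_) (sym (ℕₚ.+-suc n t)) (s≤s (ℕₚ.m≤m+n n t))))

  infix 4 _∣≈_
  record _∣≈_ (a b : Pol) : Set where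
    constructor divides≈
    field
      quotient : Pol
      equation : mulRaw a quotient ≈ b

  ∣≈-trans : ∀ {a b c} → a ∣≈ b → b ∣≈ c → a ∣≈ c
  ∣≈-trans {a} (divides≈ h₁ e₁) (divides≈ h₂ e₂) =
    divides≈ (mulRaw h₁ h₂) (≈-trans (≈-sym (mul-assoc a h₁ h₂)) (≈-trans (mul-congˡ h₂ e₁) e₂))

  ∣≈-congʳ : ∀ {a b b'} → b ≈ b' → a ∣≈ b → a ∣≈ b'
  ∣≈-congʳ e (divides≈ h e₁) = divides≈ h (≈-trans e₁ e)

  ∣≈-congˡ : ∀ {a a' b} → a ≈ a' → a ∣≈ b → a' ∣≈ b
  ∣≈-congˡ e (divides≈ h e₁) = divides≈ h (≈-trans (mul-congˡ h (≈-sym e)) e₁)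

  ∣≈-mulʳ : ∀ {a b} c → a ∣≈ b → a ∣≈ mulRaw b c
  ∣≈-mulʳ {a} c (divides≈ h e) = divides≈ (mulRaw h c) (≈-trans (≈-sym (mul-assoc a h c)) (mul-congˡ c e))

  ∣≈-add : ∀ {a b c} → a ∣≈ b → a ∣≈ c → a ∣≈ addRaw b c
  ∣≈-add {a} (divides≈ h₁ e₁) (divides≈ h₂ e₂) =
    divides≈ (addRaw h₁ h₂) (≈-trans (mul-distribˡ a h₁ h₂) (add-cong e₁ e₂))

  ∣≈-sub : ∀ {a b c} → a ∣≈ b → a ∣≈ c → a ∣≈ sub b c
  ∣≈-sub {a} d₁ (divides≈ h e) = ∣≈-add d₁ (divides≈ (neg h) (≈-trans (mul-negʳ a h) (neg-cong e)))

  ∣≈-zero : ∀ a → a ∣≈ []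
  ∣≈-zero a = divides≈ [] (mul-zeroʳ a)

  ∣≈⇒∣ₚ : ∀ p r → p ∣≈ r → p ∣ₚ r
  ∣≈⇒∣ₚ p r (divides≈ h e) = h , ≈⇒strip≡ (mulRaw p h) r e

  ∣ₚ⇒∣≈ : ∀ p r → p ∣ₚ r → p ∣≈ r
  ∣ₚ⇒∣≈ p r (h , e) = divides≈ h (strip≡⇒≈ (mulRaw p h) r e)

  -- m is the degree of the divisor b
  record DivisionResult (b a : Pol) (m : ℕ) : Set where
    constructor division
    field
      quotient remainder : Pol
      equation : a ≈ addRaw (mulRaw b quotient) remainder
      remainder-small : len remainder ≤ m

  module EuclideanDivision (b : Pol) (m : ℕ) (eb : len b ≡ suc m) where
    lb⁻¹ : Fin q
    lb⁻¹ = proj₁ (inverse (coeff b m) (leading≢0 b m eb))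

    -- the monomial (aₙ / bₘ) t^{n-m}, which kills the leading coefficient aₙ
    leadingQuotient : Pol → ℕ → Pol
    leadingQuotient a n = shiftBy (n ∸ m) ((coeff a n *F lb⁻¹) ∷ [])

    len-sub-leadingQuotient : ∀ a n → len a ≡ suc n → m ≤ n → len (sub a (mulRaw b (leadingQuotient a n))) ≤ n
    len-sub-leadingQuotient a n ea m≤n = len-≤ a' n λ i n≤i →
      subst (λ z → coeff a' z ≡ 0#) (ℕₚ.m+[n∸m]≡n n≤i) (vanishes (i ∸ n))
      where
      s = coeff a n *F lb⁻¹
      c = mulRaw b (leadingQuotient a n)
      a' = sub a c
      coeff-c : ∀ t → coeff c (n + t) ≡ s *F coeff b (m + t)
      coeff-c t = trans (coeff≡ (≈-trans (mul-shiftBy (n ∸ m) b (s ∷ [])) (shiftBy-cong (n ∸ m) (mul-constʳ b s))) (n + t))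
        (trans (cong (coeff (shiftBy (n ∸ m) (scale s b)))
                     (trans (cong (_+ t) (sym (ℕₚ.m∸n+n≡m m≤n))) (ℕₚ.+-assoc (n ∸ m) m t)))
        (trans (coeff-shiftBy (n ∸ m) (scale s b) (m + t)) (coeff-scale s b (m + t))))
      leading-cancels : s *F coeff b m ≡ coeff a n
      leading-cancels = trans (𝔽.*-assoc _ _ _)
        (trans (cong (coeff a n *F_) (trans (𝔽.*-comm _ _) (proj₂ (inverse (coeff b m) (leading≢0 b m eb)))))
          (𝔽.*-identityʳ _))
      vanishes : ∀ t → coeff a' (n + t) ≡ 0#
      vanishes zero = trans (coeff-sub a c (n + 0))
        (trans (cong₂ (λ u v → coeff a u +F (-F v)) (ℕₚ.+-identityʳ n)
                 (trans (coeff-c 0) (trans (cong (λ z → s *F coeff b z) (ℕₚ.+-identityʳ m)) leading-cancels)))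
          (𝔽.-‿inverseʳ _))
      vanishes (suc t) = trans (coeff-sub a c (n + suc t))
        (trans (cong₂ (λ u v → u +F (-F v)) (coeff-above-leading a n ea t)
                 (trans (coeff-c (suc t)) (trans (cong (s *F_) (coeff-above-leading b m eb t)) (𝔽.zeroʳ s))))
          (trans (𝔽.+-identityˡ _) -0#≡0#))

    divideFuel : ∀ fuel a → len a ≤ fuel → DivisionResult b a m
    divideFuel zero a le = division [] a (≈-sym (add-cong (mul-zeroʳ b) ≈-refl)) (ℕₚ.≤-trans le z≤n)
    divideFuel (suc fuel) a le with len a ≤? m
    ... | yes small = division [] a (≈-sym (add-cong (mul-zeroʳ b) ≈-refl)) small
    ... | no large with len a in ea
    ...   | zero = ⊥-elim (large z≤n)
    ...   | suc n = division (addRaw (quotient rec) mono) (remainder rec) equation′ (remainder-small rec)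
      where
      open DivisionResult
      mono = leadingQuotient a n
      rec = divideFuel fuel (sub a (mulRaw b mono))
        (ℕₚ.≤-trans (len-sub-leadingQuotient a n ea (ℕₚ.≤-pred (ℕₚ.≰⇒> large))) (ℕₚ.≤-pred le))
      equation′ : a ≈ addRaw (mulRaw b (addRaw (quotient rec) mono)) (remainder rec)
      equation′ = ≈-trans (≈-sym (sub-add-cancel a (mulRaw b mono))) (≈-trans (add-cong (equation rec) ≈-refl)
        (solve 4 (λ B Q R M → (B :* Q :+ R) :+ B :* M := B :* (Q :+ M) :+ R) ≈-refl b (quotient rec) (remainder rec) mono))

  divide : ∀ b m → len b ≡ suc m → ∀ a → DivisionResult b a m
  divide b m eb a = EuclideanDivision.divideFuel b m eb (len a) a ℕₚ.≤-refl

  ∣≈? : ∀ b m → len b ≡ suc m → ∀ a → Dec (b ∣≈ a)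
  ∣≈? b m eb a with divide b m eb a
  ... | division qt r eqn small with len r in er
  ...   | zero = yes (divides≈ qt (≈-sym (≈-trans eqn (≈-trans (add-cong ≈-refl (len≡0⇒≈[] r er)) (add-identityʳ _)))))
  ...   | suc k = no λ { (divides≈ h bh) → remainder-too-large h bh }
    where
    r≈ : ∀ h → mulRaw b h ≈ a → r ≈ mulRaw b (sub h qt)
    r≈ h bh = ≈-trans (≈-sym (add-sub-cancelˡ (mulRaw b qt) r))
      (≈-trans (add-cong (≈-sym eqn) ≈-refl)
        (≈-trans (add-cong (≈-sym bh) (≈-sym (mul-negʳ b qt))) (≈-sym (mul-distribˡ b h (neg qt)))))
    remainder-too-large : ∀ h → mulRaw b h ≈ a → ⊥
    remainder-too-large h bh = ℕₚ.<-irrefl refl (ℕₚ.≤-trans (subst (suc m ≤_) er b≤r) small)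
      where
      b≤r : suc m ≤ len r
      b≤r = subst (suc m ≤_) (len-cong (≈-sym (r≈ h bh)))
        (subst (_≤ len (mulRaw b (sub h qt))) eb
          (len-≤-mul b _ (λ z → len≡suc⇒nonzero r k er (≈-trans (r≈ h bh) z))))

  record Bezout (a b : Pol) : Set where
    field
      gcd u v : Pol
      gcd∣a : gcd ∣≈ a
      gcd∣b : gcd ∣≈ b
      identity : gcd ≈ addRaw (mulRaw u a) (mulRaw v b)

  bezoutFuel : ∀ fuel a b → len b ≤ fuel → Bezout a b
  bezoutFuel fuel a b le with len b in eb
  ... | zero = record
    { gcd = a ; u = 1# ∷ [] ; v = []
    ; gcd∣a = divides≈ (1# ∷ []) (mul-identityʳ a)
    ; gcd∣b = divides≈ [] (≈-trans (mul-zeroʳ a) (≈-sym (len≡0⇒≈[] b eb)))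
    ; identity = ≈-sym (≈-trans (add-identityʳ _) (mul-identityˡ a)) }
  bezoutFuel (suc fuel) a b (s≤s le) | suc m with divide b m eb a
  ... | division qt r eqn small = record
    { gcd = gcd ; u = v ; v = sub u (mulRaw v qt)
    ; gcd∣a = ∣≈-congʳ (≈-sym eqn) (∣≈-add (∣≈-mulʳ qt gcd∣a) gcd∣b)
    ; gcd∣b = gcd∣a
    ; identity = identity′ }
    where
    open Bezout (bezoutFuel fuel b r (ℕₚ.≤-trans small le))
    open SetoidReasoning (CommutativeRing.setoid polyRing)
    r≈ : r ≈ sub a (mulRaw b qt)
    r≈ = ≈-trans (≈-sym (add-sub-cancelˡ (mulRaw b qt) r)) (add-cong (≈-sym eqn) ≈-refl)
    identity′ : gcd ≈ addRaw (mulRaw v a) (mulRaw (sub u (mulRaw v qt)) b)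
    identity′ = begin
      gcd                                                          ≈⟨ identity ⟩
      addRaw (mulRaw u b) (mulRaw v r)                             ≈⟨ add-cong ≈-refl (≈-trans (mul-congʳ v r≈) (mul-distribˡ v a _)) ⟩
      addRaw (mulRaw u b) (addRaw (mulRaw v a) (mulRaw v (neg (mulRaw b qt))))
        ≈⟨ add-cong (≈-refl {mulRaw u b}) (add-cong (≈-refl {mulRaw v a}) (≈-trans (mul-negʳ v (mulRaw b qt)) (neg-cong
             (solve 3 (λ V B Q → V :* (B :* Q) := (V :* Q) :* B) ≈-refl v b qt)))) ⟩
      addRaw (mulRaw u b) (addRaw (mulRaw v a) (neg (mulRaw (mulRaw v qt) b)))
        ≈⟨ solve 3 (λ U V N → U :+ (V :+ N) := V :+ (U :+ N)) ≈-refl (mulRaw u b) (mulRaw v a) (neg (mulRaw (mulRaw v qt) b)) ⟩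
      addRaw (mulRaw v a) (addRaw (mulRaw u b) (neg (mulRaw (mulRaw v qt) b)))
        ≈⟨ add-cong ≈-refl (≈-sym (≈-trans (mul-distribʳ u (neg (mulRaw v qt)) b)
             (add-cong ≈-refl (≈-trans (mul-comm (neg (mulRaw v qt)) b)
               (≈-trans (mul-negʳ b (mulRaw v qt)) (neg-cong (mul-comm b (mulRaw v qt)))))))) ⟩
      addRaw (mulRaw v a) (mulRaw (sub u (mulRaw v qt)) b) ∎

  mul-cancelˡ : ∀ a x y → Nonzero a → mulRaw a x ≈ mulRaw a y → x ≈ y
  mul-cancelˡ a x y a≢0 e = sub≈[]⇒≈ x y x-y≈[]
    where
    a[x-y]≈[] : mulRaw a (sub x y) ≈ []
    a[x-y]≈[] = ≈-trans (mul-distribˡ a x _) (≈-trans (add-cong e (mul-negʳ a y)) (add-inverseʳ (mulRaw a y)))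
    x-y≈[] : sub x y ≈ []
    x-y≈[] with len (sub x y) in el
    ... | zero = len≡0⇒≈[] _ el
    ... | suc k = ⊥-elim (mul-nonzero a _ a≢0 (len≡suc⇒nonzero _ k el) a[x-y]≈[])

  pow : Pol → ℕ → Pol
  pow P zero = 1# ∷ []
  pow P (suc e) = mulRaw P (pow P e)

  pow-+ : ∀ P a b → pow P (a + b) ≈ mulRaw (pow P a) (pow P b)
  pow-+ P zero b = ≈-sym (mul-identityˡ _)
  pow-+ P (suc a) b = ≈-trans (mul-congʳ P (pow-+ P a b)) (≈-sym (mul-assoc P _ _))

  ^ₚ≈pow : ∀ P e → (P ^ₚ e) ≈ pow P e
  ^ₚ≈pow P zero = ≈-refl
  ^ₚ≈pow P (suc e) = ≈-trans (strip-≈ _) (mul-congʳ P (^ₚ≈pow P e))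

module PrimeFactorisation {q : ℕ} (F : FiniteField q) where
  open PolynomialDivision F public
  open NaturalCoefficientSolver (CommutativeRing.commutativeSemiring polyRing) using (solve; _:+_; _:*_; _:=_)

  len≡1⇒unit : ∀ a → len a ≡ 1 → ∃ λ c → scale c a ≈ (1# ∷ [])
  len≡1⇒unit a e with inverse (coeff a 0) (leading≢0 a 0 e)
  ... | c , a₀c≡1 = c , ≈-trans (scale-cong c (len≡1⇒const a e)) (∷-cong (trans (𝔽.*-comm c _) a₀c≡1) ≈-refl)

  module Valuation (P : Pol) (irr : Irreducible P) where
    d : ℕ
    d = deg P

    1≤d : 1 ≤ d
    1≤d = proj₁ (proj₂ irr)

    len-P : len P ≡ suc d
    len-P = trans (cong length (proj₁ irr)) (suc-pred (length P) 1≤d)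
      where
      suc-pred : ∀ n → 1 ≤ n ∸ 1 → n ≡ suc (n ∸ 1)
      suc-pred (suc n) _ = refl

    len-pow : ∀ e → len (pow P e) ≡ suc (e * d)
    len-pow zero = len-1#
    len-pow (suc e) = len-mul P _ d (e * d) len-P (len-pow e)

    pow-nonzero : ∀ e → Nonzero (pow P e)
    pow-nonzero e = len≡suc⇒nonzero _ _ (len-pow e)

    ∤1 : ¬ P ∣≈ (1# ∷ [])
    ∤1 (divides≈ h e) = ℕₚ.<-irrefl refl (ℕₚ.≤-trans (s≤s (s≤s z≤n))
      (ℕₚ.≤-trans (ℕₚ.≤-trans (ℕₚ.+-monoʳ-≤ 1 1≤d) (ℕₚ.≤-reflexive (sym len-P)))
        (subst (len P ≤_) (trans (len-cong e) len-1#)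
          (len-≤-mul P h (λ z → len≡suc⇒nonzero _ 0 len-1# (≈-trans (≈-sym e) z))))))

    ∤⇒bezout : ∀ x → ¬ P ∣≈ x → ∃₂ λ U V → (1# ∷ []) ≈ addRaw (mulRaw U x) (mulRaw V P)
    ∤⇒bezout x P∤x with bezoutFuel (len P) x P ℕₚ.≤-refl
    ... | record { gcd = g ; u = u ; v = v ; gcd∣a = g∣x ; gcd∣b = divides≈ h gh≈P ; identity = bez }
      with proj₂ (proj₂ irr) g h (trans (≈⇒strip≡ _ _ gh≈P) (proj₁ irr))
    ...   | inj₂ h-unit = ⊥-elim (P∤x (∣≈-trans P∣g g∣x))
      where
      c = proj₁ (len≡1⇒unit h h-unit)
      P∣g : P ∣≈ g
      P∣g = divides≈ (c ∷ []) (begin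
        mulRaw P (c ∷ [])        ≈⟨ mul-constʳ P c ⟩
        scale c P                ≈⟨ scale-cong c (≈-sym gh≈P) ⟩
        scale c (mulRaw g h)     ≈⟨ ≈-sym (mul-scaleʳ c g h) ⟩
        mulRaw g (scale c h)     ≈⟨ mul-congʳ g (proj₂ (len≡1⇒unit h h-unit)) ⟩
        mulRaw g (1# ∷ [])       ≈⟨ mul-identityʳ g ⟩
        g ∎)
        where open SetoidReasoning (CommutativeRing.setoid polyRing)
    ...   | inj₁ g-unit = scale c u , scale c v , (begin
        1# ∷ []                                               ≈⟨ ≈-sym (proj₂ (len≡1⇒unit g g-unit)) ⟩
        scale c g                                             ≈⟨ scale-cong c bez ⟩
        scale c (addRaw (mulRaw u x) (mulRaw v P))            ≈⟨ scale-distrib c (mulRaw u x) (mulRaw v P) ⟩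
        addRaw (scale c (mulRaw u x)) (scale c (mulRaw v P))  ≈⟨ add-cong (≈-sym (mul-scaleˡ c u x)) (≈-sym (mul-scaleˡ c v P)) ⟩
        addRaw (mulRaw (scale c u) x) (mulRaw (scale c v) P) ∎)
      where
      c = proj₁ (len≡1⇒unit g g-unit)
      open SetoidReasoning (CommutativeRing.setoid polyRing)

    ∣-mul⇒∣⊎∣ : ∀ x y → P ∣≈ mulRaw x y → P ∣≈ x ⊎ P ∣≈ y
    ∣-mul⇒∣⊎∣ x y (divides≈ k Pk≈xy) with ∣≈? P d len-P x
    ... | yes P∣x = inj₁ P∣x
    ... | no P∤x with ∤⇒bezout x P∤x
    ...   | U , V , bez = inj₂ (divides≈ (addRaw (mulRaw U k) (mulRaw V y)) (≈-sym (begin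
      y                                                   ≈⟨ ≈-sym (mul-identityʳ y) ⟩
      mulRaw y (1# ∷ [])                                  ≈⟨ mul-congʳ y bez ⟩
      mulRaw y (addRaw (mulRaw U x) (mulRaw V P))         ≈⟨ solve 5 (λ Y U X V P → Y :* (U :* X :+ V :* P) := U :* (X :* Y) :+ (V :* Y) :* P) ≈-refl y U x V P ⟩
      addRaw (mulRaw U (mulRaw x y)) (mulRaw (mulRaw V y) P) ≈⟨ add-cong (mul-congʳ U (≈-sym Pk≈xy)) ≈-refl ⟩
      addRaw (mulRaw U (mulRaw P k)) (mulRaw (mulRaw V y) P) ≈⟨ solve 5 (λ U P K V Y → U :* (P :* K) :+ (V :* Y) :* P := P :* (U :* K :+ V :* Y)) ≈-refl U P k V y ⟩
      mulRaw P (addRaw (mulRaw U k) (mulRaw V y)) ∎)))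
      where open SetoidReasoning (CommutativeRing.setoid polyRing)

    -- for x ≈ 0 the exponent is junk (bounded by the fuel)
    record Factorisation (x : Pol) : Set where
      constructor factorisation
      field
        exponent : ℕ
        cofactor : Pol
        equation : x ≈ mulRaw (pow P exponent) cofactor
        ∤cofactor : Nonzero x → ¬ P ∣≈ cofactor

    factoriseFuel : ∀ fuel x → len x ≤ fuel → Factorisation x
    factoriseFuel zero x le =
      factorisation 0 x (≈-sym (mul-identityˡ x)) λ x≢0 _ → x≢0 (len≡0⇒≈[] x (ℕₚ.n≤0⇒n≡0 le))
    factoriseFuel (suc fuel) x le with ∣≈? P d len-P x
    ... | no P∤x = factorisation 0 x (≈-sym (mul-identityˡ x)) λ _ → P∤x
    ... | yes (divides≈ h Ph≈x) with factoriseFuel fuel h len-h≤fuel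
      where
      len-h≤fuel : len h ≤ fuel
      len-h≤fuel with len h in eh
      ... | zero = z≤n
      ... | suc k = ℕₚ.≤-pred (ℕₚ.≤-trans (s≤s (ℕₚ.+-monoˡ-≤ k 1≤d))
        (subst (_≤ suc fuel) (trans (len-cong (≈-sym Ph≈x)) (len-mul P h d k len-P eh)) le))
    ...   | factorisation v y h≈Pᵛy P∤y = factorisation (suc v) y
      (≈-trans (≈-sym Ph≈x) (≈-trans (mul-congʳ P h≈Pᵛy) (≈-sym (mul-assoc P _ y))))
      λ x≢0 → P∤y (λ h≈0 → x≢0 (≈-trans (≈-sym Ph≈x) (≈-trans (mul-congʳ P h≈0) (mul-zeroʳ P))))

    factorise : ∀ x → Factorisation x
    factorise x = factoriseFuel (len x) x ℕₚ.≤-refl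

    valuation : Pol → ℕ
    valuation x = Factorisation.exponent (factorise x)

    pow∣⇔≤ : ∀ x V y → x ≈ mulRaw (pow P V) y → ¬ P ∣≈ y → ∀ e → (pow P e ∣≈ x → e ≤ V) × (e ≤ V → pow P e ∣≈ x)
    pow∣⇔≤ x V y x≈PᵛY P∤y e = to , from
      where
      from : e ≤ V → pow P e ∣≈ x
      from e≤V = divides≈ (mulRaw (pow P (V ∸ e)) y)
        (≈-trans (≈-sym (mul-assoc (pow P e) (pow P (V ∸ e)) y)) (≈-trans (mul-congˡ y Pᵉ⁺⁽ⱽ⁻ᵉ⁾≈Pⱽ) (≈-sym x≈PᵛY)))
        where
        Pᵉ⁺⁽ⱽ⁻ᵉ⁾≈Pⱽ : mulRaw (pow P e) (pow P (V ∸ e)) ≈ pow P V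
        Pᵉ⁺⁽ⱽ⁻ᵉ⁾≈Pⱽ = ≈-sym (subst (λ z → pow P z ≈ mulRaw (pow P e) (pow P (V ∸ e))) (ℕₚ.m+[n∸m]≡n e≤V) (pow-+ P e (V ∸ e)))
      -- if e > V, cancelling Pⱽ from Pᵉ h ≈ Pⱽ y leaves P ∣ y
      to : pow P e ∣≈ x → e ≤ V
      to (divides≈ h Pᵉh≈x) with e ≤? V
      ... | yes e≤V = e≤V
      ... | no e≰V = ⊥-elim (P∤y (divides≈ (mulRaw (pow P t) h) (mul-cancelˡ (pow P V) _ _ (pow-nonzero V) (begin
          mulRaw (pow P V) (mulRaw P (mulRaw (pow P t) h))  ≈⟨ solve 4 (λ A B C H → A :* (B :* (C :* H)) := (A :* (B :* C)) :* H) ≈-refl (pow P V) P (pow P t) h ⟩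
          mulRaw (mulRaw (pow P V) (pow P (suc t))) h         ≈⟨ mul-congˡ h (≈-sym (pow-+ P V (suc t))) ⟩
          mulRaw (pow P (V + suc t)) h                        ≡⟨ cong (λ z → mulRaw (pow P z) h) V+1+t≡e ⟩
          mulRaw (pow P e) h                                  ≈⟨ Pᵉh≈x ⟩
          x                                                   ≈⟨ x≈PᵛY ⟩
          mulRaw (pow P V) y ∎))))
        where
        open SetoidReasoning (CommutativeRing.setoid polyRing)
        t = e ∸ suc V
        V+1+t≡e : V + suc t ≡ e
        V+1+t≡e = trans (ℕₚ.+-suc V t) (ℕₚ.m+[n∸m]≡n (ℕₚ.≰⇒> e≰V))

-- The coding δ of polynomials by natural numbers

module PolynomialEncoding {q : ℕ} (F : FiniteField q) where
  open PrimeFactorisation F public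

  2≤q : 2 ≤ q
  2≤q = subst (_< q) one-index (Finₚ.toℕ<n 1#)

  instance
    q-nonZero : NonZero q
    q-nonZero = ℕ.>-nonZero (ℕₚ.≤-trans (s≤s z≤n) 2≤q)

  [a*m+r]/m≡a+r/m : ∀ a r m .{{_ : NonZero m}} → (a * m + r) / m ≡ a + r / m
  [a*m+r]/m≡a+r/m a r m =
    trans (DivMod.+-distrib-/-∣ˡ r (divides-refl a)) (cong (_+ r / m) (DivMod.m*n/n≡m a m))

  [a*m+r]%m≡r%m : ∀ a r m .{{_ : NonZero m}} → (a * m + r) % m ≡ r % m
  [a*m+r]%m≡r%m a r m = trans (cong (_% m) (ℕₚ.+-comm (a * m) r)) (DivMod.[m+kn]%n≡m%n r a m)

  _/q^_ : ℕ → ℕ → ℕ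
  n /q^ j = _/_ n (q ^ j) {{ℕₚ.m^n≢0 q j}}

  digit : ℕ → Fin q
  digit n = fromℕ< (DivMod.m%n<n n q)

  toℕ-digit : ∀ n → toℕ (digit n) ≡ n % q
  toℕ-digit n = Finₚ.toℕ-fromℕ< (DivMod.m%n<n n q)

  digit-cong : ∀ {m n} → m % q ≡ n % q → digit m ≡ digit n
  digit-cong e = Finₚ.toℕ-injective (trans (toℕ-digit _) (trans e (sym (toℕ-digit _))))

  digit-0 : digit 0 ≡ 0#
  digit-0 = Finₚ.toℕ-injective
    (trans (toℕ-digit 0) (trans (DivMod.m<n⇒m%n≡m (ℕₚ.≤-trans (s≤s z≤n) 2≤q)) (sym zero-index)))

  digit-toℕ+q* : ∀ (x : Fin q) m → digit (toℕ x + q * m) ≡ x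
  digit-toℕ+q* x m = Finₚ.toℕ-injective (trans (toℕ-digit _)
    (trans (cong (_% q) (trans (ℕₚ.+-comm (toℕ x) (q * m)) (cong (_+ toℕ x) (ℕₚ.*-comm q m))))
      (trans ([a*m+r]%m≡r%m m (toℕ x) q) (DivMod.m<n⇒m%n≡m (Finₚ.toℕ<n x)))))

  [1+n]/q<1+n : ∀ n → suc n / q < suc n
  [1+n]/q<1+n n = DivMod.m/n<m (suc n) q (ℕₚ.≤-trans (s≤s (s≤s z≤n)) 2≤q)

  decodeFuel-irrelevant : ∀ k k' n → n ≤ k → n ≤ k' → decodeFuel k n ≡ decodeFuel k' n
  decodeFuel-irrelevant zero zero n _ _ = refl
  decodeFuel-irrelevant zero (suc k') zero _ _ = refl
  decodeFuel-irrelevant (suc k) zero zero _ _ = refl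
  decodeFuel-irrelevant (suc k) (suc k') zero _ _ = refl
  decodeFuel-irrelevant (suc k) (suc k') (suc n) (s≤s le) (s≤s le') = cong (digit (suc n) ∷_)
    (decodeFuel-irrelevant k k' _ (ℕₚ.≤-trans (ℕₚ.m<1+n⇒m≤n ([1+n]/q<1+n n)) le)
                                  (ℕₚ.≤-trans (ℕₚ.m<1+n⇒m≤n ([1+n]/q<1+n n)) le'))

  decode-step : ∀ n → decode n ≈ (digit n ∷ decode (n / q))
  decode-step zero = mk≈ λ
    { zero → sym digit-0 ; (suc i) → cong (λ z → coeff (decode z) i) (sym (DivMod.0/n≡0 q)) }
  decode-step (suc n) = ∷-cong refl (mk≈ λ i → cong (λ z → coeff z i)
    (decodeFuel-irrelevant n _ _ (ℕₚ.m<1+n⇒m≤n ([1+n]/q<1+n n)) ℕₚ.≤-refl))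

  decode-cong : ∀ {m n} → m ≡ n → decode m ≈ decode n
  decode-cong refl = ≈-refl

  δ-≈[] : ∀ {a} → a ≈ [] → δ a ≡ 0
  δ-≈[] {[]} e = refl
  δ-≈[] {x ∷ a} e = trans (cong₂ (λ u v → toℕ u + q * v) (coeff≡ e 0) (δ-≈[] (≈[]-tail e)))
    (trans (cong (_+ q * 0) zero-index) (ℕₚ.*-zeroʳ q))

  δ-cong : ∀ {a b} → a ≈ b → δ a ≡ δ b
  δ-cong {[]} {[]} e = refl
  δ-cong {x ∷ a} {y ∷ b} e = cong₂ (λ u v → toℕ u + q * v) (coeff≡ e 0) (δ-cong (≈-tail e))
  δ-cong {x ∷ a} {[]} e = δ-≈[] e
  δ-cong {[]} {y ∷ b} e = sym (δ-≈[] (≈-sym e))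

  δ-decodeFuel : ∀ k n → n ≤ k → δ (decode n) ≡ n
  δ-decodeFuel k zero _ = refl
  δ-decodeFuel (suc k) (suc n) (s≤s le) = trans (δ-cong (decode-step (suc n)))
    (trans (cong₂ (λ u v → u + q * v) (toℕ-digit (suc n))
             (δ-decodeFuel k (suc n / q) (ℕₚ.≤-trans (ℕₚ.m<1+n⇒m≤n ([1+n]/q<1+n n)) le)))
    (trans (cong (suc n % q +_) (ℕₚ.*-comm q _)) (sym (DivMod.m≡m%n+[m/n]*n (suc n) q))))

  δ-decode : ∀ n → δ (decode n) ≡ n
  δ-decode n = δ-decodeFuel n n ℕₚ.≤-refl

  decode-δ : ∀ a → decode (δ a) ≈ a
  decode-δ [] = ≈-refl
  decode-δ (x ∷ a) = ≈-trans (decode-step (δ (x ∷ a)))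
    (∷-cong (digit-toℕ+q* x (δ a)) (≈-trans (decode-cong δ[x∷a]/q≡δa) (decode-δ a)))
    where
    δ[x∷a]/q≡δa : (toℕ x + q * δ a) / q ≡ δ a
    δ[x∷a]/q≡δa = trans (cong (_/ q) (trans (ℕₚ.+-comm (toℕ x) _) (cong (_+ toℕ x) (ℕₚ.*-comm q (δ a)))))
      (trans ([a*m+r]/m≡a+r/m (δ a) (toℕ x) q) (trans (cong (δ a +_) (DivMod.m<n⇒m/n≡0 (Finₚ.toℕ<n x))) (ℕₚ.+-identityʳ _)))

  δ-injective : ∀ {a b} → δ a ≡ δ b → a ≈ b
  δ-injective {a} {b} e = ≈-trans (≈-sym (decode-δ a)) (≈-trans (decode-cong e) (decode-δ b))

  length-strip : ∀ a → length (strip a) ≤ length a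
  length-strip [] = z≤n
  length-strip (x ∷ a) = subst (_≤ suc (length a)) (cong length (sym (strip-∷ x a)))
    (length-stripCons x (strip a) (length-strip a))
    where
    length-stripCons : ∀ x s → length s ≤ length a → length (stripCons x s) ≤ suc (length a)
    length-stripCons x (y ∷ s) le = s≤s le
    length-stripCons x [] le with x ≟ 0#
    ... | yes _ = z≤n
    ... | no _ = s≤s z≤n

  length-decodeFuel : ∀ k n → length (decodeFuel k n) ≤ k
  length-decodeFuel zero n = z≤n
  length-decodeFuel (suc k) zero = z≤n
  length-decodeFuel (suc k) (suc n) = s≤s (length-decodeFuel k _)

  len-decode-≤ : ∀ n → len (decode n) ≤ n
  len-decode-≤ n = ℕₚ.≤-trans (length-strip (decode n)) (length-decodeFuel n n)

  len≤δ : ∀ a → len a ≤ δ a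
  len≤δ a = subst (_≤ δ a) (len-cong (decode-δ a)) (len-decode-≤ (δ a))

  δ<q^length : ∀ D a → length a ≤ D → δ a < q ^ D
  δ<q^length zero [] _ = s≤s z≤n
  δ<q^length (suc D) [] _ = ℕₚ.m^n>0 q (suc D)
  δ<q^length (suc D) (x ∷ a) (s≤s le) = ℕₚ.≤-trans (ℕₚ.+-monoˡ-≤ (q * δ a) (Finₚ.toℕ<n x))
    (subst (_≤ q * q ^ D) (ℕₚ.*-suc q (δ a)) (ℕₚ.*-monoʳ-≤ q (δ<q^length D a le)))

  δ<q^len : ∀ D a → len a ≤ D → δ a < q ^ D
  δ<q^len D a le = subst (_< q ^ D) (δ-cong (strip-≈ a)) (δ<q^length D (strip a) le)

  len-∷ : ∀ x p → len (x ∷ p) ≤ suc (len p)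
  len-∷ x p = len-≤ (x ∷ p) (suc (len p)) λ { zero () ; (suc i) (s≤s le) → coeff-≥len p i le }

  len-decode-< : ∀ D r → r < q ^ D → len (decode r) ≤ D
  len-decode-< zero r lt = subst (λ z → len (decode z) ≤ 0) (sym (ℕₚ.n<1⇒n≡0 lt)) z≤n
  len-decode-< (suc D) r lt = subst (_≤ suc D) (sym (len-cong (decode-step r)))
    (ℕₚ.≤-trans (len-∷ (digit r) (decode (r / q)))
      (s≤s (len-decode-< D (r / q) (DivMod.m<n*o⇒m/o<n (subst (r <_) (ℕₚ.*-comm q (q ^ D)) lt)))))

  decode-*q^+ : ∀ D m r → r < q ^ D → decode (m * q ^ D + r) ≈ addRaw (shiftBy D (decode m)) (decode r)
  decode-*q^+ zero m r lt with ℕₚ.n<1⇒n≡0 lt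
  ... | refl = ≈-trans (decode-cong (trans (ℕₚ.+-identityʳ _) (ℕₚ.*-identityʳ m))) (≈-sym (add-identityʳ _))
  decode-*q^+ (suc D) m r lt = ≈-trans (decode-step n) (mk≈ λ
    { zero → trans (digit-cong n%q≡r%q)
        (sym (trans (coeff-add (0# ∷ shiftBy D (decode m)) (decode r) 0) (trans (𝔽.+-identityˡ _) (coeff≡ (decode-step r) 0))))
    ; (suc i) → trans (cong (λ z → coeff (decode z) i) n/q≡)
        (trans (coeff≡ (decode-*q^+ D m (r / q) r/q<q^D) i) (trans (coeff-add (shiftBy D (decode m)) _ i)
          (sym (trans (coeff-add (0# ∷ shiftBy D (decode m)) (decode r) (suc i))
            (cong (coeff (shiftBy D (decode m)) i +F_) (coeff≡ (decode-step r) (suc i))))))) })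
    where
    n = m * q ^ suc D + r
    n≡ : n ≡ (m * q ^ D) * q + r
    n≡ = cong (_+ r) (trans (cong (m *_) (ℕₚ.*-comm q (q ^ D))) (sym (ℕₚ.*-assoc m (q ^ D) q)))
    n/q≡ : n / q ≡ m * q ^ D + r / q
    n/q≡ = trans (cong (_/ q) n≡) ([a*m+r]/m≡a+r/m (m * q ^ D) r q)
    n%q≡r%q : n % q ≡ r % q
    n%q≡r%q = trans (cong (_% q) n≡) ([a*m+r]%m≡r%m (m * q ^ D) r q)
    r/q<q^D : r / q < q ^ D
    r/q<q^D = DivMod.m<n*o⇒m/o<n (subst (r <_) (ℕₚ.*-comm q (q ^ D)) lt)

module ResidueCounting {q : ℕ} (F : FiniteField q) where
  open PolynomialEncoding F public

  -- Q has degree D; the residues modulo Q are the polynomials decode r with r < q^D.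
  module ResiduesModulo (Q : Pol) (D : ℕ) (len-Q : len Q ≡ suc D) where
    residue-unique : ∀ c r₁ r₂ → r₁ < q ^ D → r₂ < q ^ D →
      Q ∣≈ sub c (decode r₁) → Q ∣≈ sub c (decode r₂) → r₁ ≡ r₂
    residue-unique c r₁ r₂ r₁< r₂< Q∣₁ Q∣₂ =
      trans (sym (δ-decode r₁)) (trans (δ-cong (≈-sym (sub≈[]⇒≈ (decode r₂) (decode r₁) w≈[]))) (δ-decode r₂))
      where
      w = sub (decode r₂) (decode r₁)
      Q∣w : Q ∣≈ w
      Q∣w = ∣≈-congʳ (sub-sub-cancelˡ c _ _) (∣≈-sub Q∣₁ Q∣₂)
      len-w≤D : len w ≤ D
      len-w≤D = len-sub-≤ (decode r₂) (decode r₁) D (len-decode-< D r₂ r₂<) (len-decode-< D r₁ r₁<)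
      -- a nonzero multiple of Q has degree at least D
      w≈[] : w ≈ []
      w≈[] with len w in ew | Q∣w
      ... | zero | _ = len≡0⇒≈[] w ew
      ... | suc k | divides≈ h Qh≈w = ⊥-elim (ℕₚ.<-irrefl refl (ℕₚ.≤-trans
        (subst (_≤ len w) len-Q (subst (len Q ≤_) (len-cong Qh≈w)
          (len-≤-mul Q h (λ z → len≡suc⇒nonzero w k ew (≈-trans (≈-sym Qh≈w) z))))) len-w≤D))

    residue-exists : ∀ c → ∃ λ r → r < q ^ D × Q ∣≈ sub c (decode r)
    residue-exists c with divide Q D len-Q c
    ... | division qt ρ eqn small = δ ρ , δ<q^len D ρ small ,
      divides≈ qt (≈-sym (≈-trans (sub-cong eqn (decode-δ ρ)) (add-sub-cancelʳ _ ρ)))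

    module Congruent (h : Pol) where
      hit : ℕ → ℕ
      hit n = indicator (∣≈? Q D len-Q (sub h (decode n)))

      hitBlock : ℕ → ℕ → ℕ
      hitBlock j r = indicator (∣≈? Q D len-Q (sub (sub h (shiftBy D (decode j))) (decode r)))

      hit-block : ∀ j r → r < q ^ D → hit (j * q ^ D + r) ≡ hitBlock j r
      hit-block j r r< = indicator-cong (∣≈-congʳ e) (∣≈-congʳ (≈-sym e)) _ _
        where
        e = ≈-trans (sub-cong ≈-refl (decode-*q^+ D j r r<)) (sub-add h _ _)

      block-count : ∀ j → sumTo (q ^ D) (λ r → hit (j * q ^ D + r)) ≡ 1
      block-count j with residue-exists (sub h (shiftBy D (decode j)))
      ... | r₀ , r₀< , Q∣₀ = sumTo-single (q ^ D) r₀ r₀<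
        (trans (hit-block j r₀ r₀<) (indicator-yes _ Q∣₀))
        (λ r r< r≢r₀ → trans (hit-block j r r<)
          (indicator-no _ (λ Q∣ → r≢r₀ (residue-unique _ r r₀ r< r₀< Q∣ Q∣₀))))

      hit-count : sumTo (δ h) hit ≡ δ h /q^ D
      hit-count = begin
        sumTo N hit                                                ≡⟨ cong (λ z → sumTo z hit) N≡ ⟩
        sumTo (j₀ * B + r₁) hit                                    ≡⟨ sumTo-+ (j₀ * B) r₁ hit ⟩
        sumTo (j₀ * B) hit + sumTo r₁ (λ r → hit (j₀ * B + r))     ≡⟨ cong₂ _+_ complete-blocks partial-block ⟩
        j₀ + 0                                                     ≡⟨ ℕₚ.+-identityʳ j₀ ⟩
        j₀ ∎
        where
        open ≡-Reasoning
        B = q ^ D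
        instance
          B-nonZero : NonZero B
          B-nonZero = ℕₚ.m^n≢0 q D
        N = δ h
        j₀ = N / B
        r₁ = N % B
        N≡ : N ≡ j₀ * B + r₁
        N≡ = trans (DivMod.m≡m%n+[m/n]*n N B) (ℕₚ.+-comm (N % B) (j₀ * B))
        r₁<B : r₁ < B
        r₁<B = DivMod.m%n<n N B
        complete-blocks : sumTo (j₀ * B) hit ≡ j₀
        complete-blocks = trans (sumTo-* j₀ B hit)
          (trans (sumTo-cong j₀ (λ j _ → block-count j)) (trans (sumTo-const j₀ 1) (ℕₚ.*-identityʳ j₀)))
        Q∣r₁ : Q ∣≈ sub (sub h (shiftBy D (decode j₀))) (decode r₁)
        Q∣r₁ = ∣≈-congʳ (≈-sym (≈-trans (≈-sym (sub-add h _ _))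
          (≈-trans (sub-cong (≈-sym (decode-δ h)) (≈-sym (decode-*q^+ D j₀ r₁ r₁<B)))
            (≈-trans (sub-cong ≈-refl (decode-cong (sym N≡))) (sub-self (decode N)))))) (∣≈-zero Q)
        -- in block j₀ the unique hit is r₁ (the code N itself), so the partial block below r₁ has none
        partial-block : sumTo r₁ (λ r → hit (j₀ * B + r)) ≡ 0
        partial-block = sumTo-zeros r₁ λ r r<r₁ → trans (hit-block j₀ r (ℕₚ.<-trans r<r₁ r₁<B))
          (indicator-no _ (λ Q∣r → ℕₚ.<-irrefl (residue-unique _ r r₁ (ℕₚ.<-trans r<r₁ r₁<B) r₁<B Q∣r Q∣r₁) r<r₁))

-- Legendre sums in base q^d

module LegendreSum (q : ℕ) (2≤q : 2 ≤ q) (d : ℕ) (1≤d : 1 ≤ d) where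
  base : ℕ
  base = q ^ d

  power : ℕ → ℕ
  power j = q ^ (d * j)

  private instance
    q-nonZero : NonZero q
    q-nonZero = ℕ.>-nonZero (ℕₚ.≤-trans (s≤s z≤n) 2≤q)

  instance
    power-nonZero : ∀ {j} → NonZero (power j)
    power-nonZero {j} = ℕₚ.m^n≢0 q (d * j)

    base-nonZero : NonZero base
    base-nonZero = ℕₚ.m^n≢0 q d

  legendre : ℕ → ℕ → ℕ
  legendre K n = sumTo K (λ k → n / power (suc k))

  repunit : ℕ → ℕ
  repunit j = sumTo j power

  power-0 : power 0 ≡ 1
  power-0 = cong (q ^_) (ℕₚ.*-zeroʳ d)

  power-1 : power 1 ≡ base
  power-1 = cong (q ^_) (ℕₚ.*-identityʳ d)

  power-+ : ∀ a b → power (a + b) ≡ power a * power b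
  power-+ a b = trans (cong (q ^_) (ℕₚ.*-distribˡ-+ d a b)) (ℕₚ.^-distribˡ-+-* q (d * a) (d * b))

  power-suc : ∀ j → power (suc j) ≡ base * power j
  power-suc j = trans (cong (q ^_) (ℕₚ.*-suc d j)) (ℕₚ.^-distribˡ-+-* q d (d * j))

  power>0 : ∀ j → 0 < power j
  power>0 j = ℕₚ.m^n>0 q (d * j)

  2≤base : 2 ≤ base
  2≤base = ℕₚ.≤-trans 2≤q (subst (_≤ base) (ℕₚ.*-identityʳ q) (ℕₚ.^-monoʳ-≤ q 1≤d))

  power-mono-≤ : ∀ {i j} → i ≤ j → power i ≤ power j
  power-mono-≤ le = ℕₚ.^-monoʳ-≤ q (ℕₚ.*-monoʳ-≤ d le)

  n<power : ∀ j → j < power j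
  n<power zero = power>0 0
  n<power (suc j) = subst (suc j <_) (sym (power-suc j)) (ℕₚ.≤-trans (ℕₚ.+-mono-≤ (power>0 j) (n<power j))
    (ℕₚ.≤-trans (ℕₚ.≤-reflexive (cong (power j +_) (sym (ℕₚ.+-identityʳ (power j))))) (ℕₚ.*-monoˡ-≤ (power j) 2≤base)))

  [a*power+r]/power : ∀ a r j → (a * power j + r) / power j ≡ a + r / power j
  [a*power+r]/power a r j = trans (DivMod.+-distrib-/-∣ˡ r (divides-refl a)) (cong (_+ r / power j) (DivMod.m*n/n≡m a (power j)))

  <power⇒/≡0 : ∀ {n} j → n < power j → n / power j ≡ 0
  <power⇒/≡0 j lt = DivMod.m<n⇒m/n≡0 lt

  repunit-suc : ∀ j → repunit (suc j) ≡ 1 + base * repunit j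
  repunit-suc j = cong₂ _+_ power-0 (trans (sumTo-cong j (λ i _ → power-suc i)) (sumTo-*ˡ j base power))

  legendre-0 : ∀ K → legendre K 0 ≡ 0
  legendre-0 K = sumTo-zeros K (λ k _ → <power⇒/≡0 (suc k) (power>0 (suc k)))

  -- the terms with k ≥ n vanish since n < power (suc k)
  legendre-extend : ∀ K n → n ≤ K → legendre K n ≡ legendre n n
  legendre-extend K n n≤K = begin
    legendre K n                                                      ≡⟨ cong (λ z → legendre z n) (sym (ℕₚ.m+[n∸m]≡n n≤K)) ⟩
    legendre (n + (K ∸ n)) n                                          ≡⟨ sumTo-+ n (K ∸ n) _ ⟩
    legendre n n + sumTo (K ∸ n) (λ r → n / power (suc (n + r)))      ≡⟨ cong (legendre n n +_) vanishing ⟩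
    legendre n n + 0                                                  ≡⟨ ℕₚ.+-identityʳ _ ⟩
    legendre n n ∎
    where
    open ≡-Reasoning
    vanishing : sumTo (K ∸ n) (λ r → n / power (suc (n + r))) ≡ 0
    vanishing = sumTo-zeros (K ∸ n) λ r _ →
      <power⇒/≡0 (suc (n + r)) (ℕₚ.<-trans (s≤s (ℕₚ.m≤m+n n r)) (n<power (suc (n + r))))

  legendre-mono-≤ : ∀ K {m n} → m ≤ n → legendre K m ≤ legendre K n
  legendre-mono-≤ K le = sumTo-mono-≤ K (λ k _ → DivMod./-monoˡ-≤ (power (suc k)) le)

  -- adding c q^{dj} (c < q^d) to a number below q^{dj} adds c to each of the
  -- quotients by q^{d(k+1)} for k < j and leaves the others zero
  legendre-digit : ∀ K c rest j → c < base → rest < power j → j ≤ K →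
    legendre K (c * power j + rest) ≡ c * repunit j + legendre K rest
  legendre-digit K c rest j c<base rest< j≤K = begin
    legendre K n
      ≡⟨ cong (λ z → legendre z n) (sym K≡) ⟩
    legendre (j + (K ∸ j)) n
      ≡⟨ sumTo-+ j (K ∸ j) _ ⟩
    legendre j n + high n
      ≡⟨ cong₂ _+_ low (trans (high-vanishes n n<power[1+j]) (sym (high-vanishes rest (ℕₚ.<-trans rest< (power-suc>power j))))) ⟩
    (c * repunit j + legendre j rest) + high rest
      ≡⟨ ℕₚ.+-assoc (c * repunit j) _ _ ⟩
    c * repunit j + (legendre j rest + high rest)
      ≡⟨ cong (c * repunit j +_) (sym (sumTo-+ j (K ∸ j) _)) ⟩
    c * repunit j + legendre (j + (K ∸ j)) rest
      ≡⟨ cong (λ z → c * repunit j + legendre z rest) K≡ ⟩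
    c * repunit j + legendre K rest ∎
    where
    open ≡-Reasoning
    n = c * power j + rest
    K≡ : j + (K ∸ j) ≡ K
    K≡ = ℕₚ.m+[n∸m]≡n j≤K
    high : ℕ → ℕ
    high m = sumTo (K ∸ j) (λ r → m / power (suc (j + r)))
    power-suc>power : ∀ j → power j < power (suc j)
    power-suc>power j = subst (power j <_) (trans (ℕₚ.*-comm (power j) base) (sym (power-suc j)))
      (ℕₚ.m<m*n (power j) base 2≤base)
    n<power[1+j] : n < power (suc j)
    n<power[1+j] = ℕₚ.≤-trans (ℕₚ.+-monoʳ-< (c * power j) rest<)
      (subst (_≤ power (suc j)) (ℕₚ.+-comm (power j) (c * power j))
        (subst (suc c * power j ≤_) (sym (power-suc j)) (ℕₚ.*-monoˡ-≤ (power j) c<base)))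
    high-vanishes : ∀ m → m < power (suc j) → high m ≡ 0
    high-vanishes m m< = sumTo-zeros (K ∸ j) λ r _ →
      <power⇒/≡0 (suc (j + r)) (ℕₚ.<-≤-trans m< (power-mono-≤ (s≤s (ℕₚ.m≤m+n j r))))
    term : ∀ k → k < j → n / power (suc k) ≡ c * power (j ∸ suc k) + rest / power (suc k)
    term k k<j = trans (cong (_/ power (suc k)) n≡) ([a*power+r]/power (c * power (j ∸ suc k)) rest (suc k))
      where
      n≡ : n ≡ c * power (j ∸ suc k) * power (suc k) + rest
      n≡ = cong (_+ rest) (trans (cong (c *_) (trans (cong power
        (sym (trans (ℕₚ.+-comm (j ∸ suc k) (suc k)) (ℕₚ.m+[n∸m]≡n k<j)))) (power-+ (j ∸ suc k) (suc k))))
        (sym (ℕₚ.*-assoc c _ _)))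
    low : legendre j n ≡ c * repunit j + legendre j rest
    low = trans (sumTo-cong j term) (trans (sumTo-distrib j _ _)
      (cong (_+ legendre j rest) (trans (sumTo-*ˡ j c (λ k → power (j ∸ suc k))) (cong (c *_) (sumTo-reverse j power)))))

  -- q^{dj} - 1 has all base-q^d digits equal to q^d - 1
  legendre-power∸1 : ∀ K j → j ≤ K → legendre K (power j ∸ 1) + j ≡ repunit j
  legendre-power∸1 K zero _ = trans (ℕₚ.+-identityʳ _) (trans (cong (legendre K) (cong (_∸ 1) power-0)) (legendre-0 K))
  legendre-power∸1 K (suc j) 1+j≤K = begin
    legendre K (power (suc j) ∸ 1) + suc j                  ≡⟨ cong (λ z → legendre K z + suc j) split ⟩
    legendre K (b' * power j + p') + suc j                  ≡⟨ cong (_+ suc j) (legendre-digit K b' p' j b'<base p'<power j≤K) ⟩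
    b' * repunit j + legendre K p' + suc j                  ≡⟨ rearrange (b' * repunit j) (legendre K p') j ⟩
    suc (b' * repunit j + (legendre K p' + j))              ≡⟨ cong (λ z → suc (b' * repunit j + z)) (legendre-power∸1 K j j≤K) ⟩
    suc (b' * repunit j + repunit j)                        ≡⟨ cong suc (ℕₚ.+-comm (b' * repunit j) (repunit j)) ⟩
    1 + suc b' * repunit j                                  ≡⟨ cong (λ z → 1 + z * repunit j) (sym base≡) ⟩
    1 + base * repunit j                                    ≡⟨ sym (repunit-suc j) ⟩
    repunit (suc j) ∎
    where
    open ≡-Reasoning
    open +-*-Solver
    j≤K = ℕₚ.≤-trans (ℕₚ.n≤1+n j) 1+j≤K
    b' = base ∸ 1
    base≡ : base ≡ suc b'
    base≡ = sym (ℕₚ.m+[n∸m]≡n (ℕₚ.≤-trans (s≤s z≤n) 2≤base))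
    b'<base : b' < base
    b'<base = subst (b' <_) (sym base≡) (ℕₚ.n<1+n b')
    p' = power j ∸ 1
    power≡ : power j ≡ suc p'
    power≡ = sym (ℕₚ.m+[n∸m]≡n (power>0 j))
    p'<power : p' < power j
    p'<power = subst (p' <_) (sym power≡) (ℕₚ.n<1+n p')
    split : power (suc j) ∸ 1 ≡ b' * power j + p'
    split = trans (cong (_∸ 1) (trans (power-suc j) (cong₂ _*_ base≡ power≡)))
      (trans (ℕₚ.+-comm p' (b' * suc p')) (cong (λ z → b' * z + p') (sym power≡)))
    rearrange : ∀ x y z → x + y + suc z ≡ suc (x + (y + z))
    rearrange = solve 3 (λ x y z → x :+ y :+ (con 1 :+ z) := con 1 :+ (x :+ (y :+ z))) refl

  [n∸1]/m≡n/m : ∀ n m .{{_ : NonZero m}} → ¬ (m ∣ n) → (n ∸ 1) / m ≡ n / m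
  [n∸1]/m≡n/m n m m∤n with n % m in e
  ... | zero = ⊥-elim (m∤n (m%n≡0⇒n∣m n m e))
  ... | suc r = begin
    (n ∸ 1) / m          ≡⟨ cong (_/ m) n∸1≡ ⟩
    (n / m * m + r) / m  ≡⟨ trans (DivMod.+-distrib-/-∣ˡ r (divides-refl (n / m))) (cong (_+ r / m) (DivMod.m*n/n≡m (n / m) m)) ⟩
    n / m + r / m        ≡⟨ cong (n / m +_) (DivMod.m<n⇒m/n≡0 r<m) ⟩
    n / m + 0            ≡⟨ ℕₚ.+-identityʳ _ ⟩
    n / m ∎
    where
    open ≡-Reasoning
    n∸1≡ : n ∸ 1 ≡ n / m * m + r
    n∸1≡ = cong (_∸ 1) (trans (DivMod.m≡m%n+[m/n]*n n m)
      (trans (ℕₚ.+-comm (n % m) _) (trans (cong (n / m * m +_) e) (ℕₚ.+-suc (n / m * m) r))))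
    r<m : r < m
    r<m = ℕₚ.<-trans (ℕₚ.n<1+n r) (subst (_< m) e (DivMod.m%n<n n m))

  legendre-∸1 : ∀ K n → ¬ (base ∣ n) → legendre K (n ∸ 1) ≡ legendre K n
  legendre-∸1 K n base∤n = sumTo-cong K λ k _ → [n∸1]/m≡n/m n (power (suc k))
    (λ power∣n → base∤n (∣-trans (divides (power k) (trans (power-suc k) (ℕₚ.*-comm base (power k)))) power∣n))

module FactorialValuation {q : ℕ} (F : FiniteField q) where
  open ResidueCounting F public
  open NaturalCoefficientSolver (CommutativeRing.commutativeSemiring polyRing) using (solve; _:+_; _:*_; _:=_)

  module LegendreFormula (P : Pol) (irr : Irreducible P) where
    open Valuation P irr public
    open LegendreSum q 2≤q d 1≤d public using (legendre)

    product-factorisation : ∀ (x : ℕ → Pol) f N → (∀ i → i < N → Nonzero (x (f i))) →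
      ∃ λ y → (foldr _*ₚ_ 1ₚ (map x (applyUpTo f N)) ≈ mulRaw (pow P (sumTo N (λ i → valuation (x (f i))))) y)
            × ¬ P ∣≈ y
    product-factorisation x f zero _ = (1# ∷ []) , ≈-sym (mul-identityˡ _) , ∤1
    product-factorisation x f (suc N) nonzero
      with factorise (x (f 0)) | product-factorisation x (λ i → f (suc i)) N (λ i lt → nonzero (suc i) (s≤s lt))
    ... | factorisation a y₁ e₁ P∤y₁ | y₂ , e₂ , P∤y₂ = mulRaw y₁ y₂ , equation , P∤y₁y₂
      where
      a' = sumTo N (λ i → valuation (x (f (suc i))))
      equation : foldr _*ₚ_ 1ₚ (map x (applyUpTo f (suc N))) ≈ mulRaw (pow P (a + a')) (mulRaw y₁ y₂)
      equation = ≈-trans (strip-≈ _) (≈-trans (mul-cong e₁ e₂) (≈-trans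
        (solve 4 (λ A Y₁ B Y₂ → (A :* Y₁) :* (B :* Y₂) := (A :* B) :* (Y₁ :* Y₂)) ≈-refl (pow P a) y₁ (pow P a') y₂)
        (mul-congˡ _ (≈-sym (pow-+ P a a')))))
      P∤y₁y₂ : ¬ P ∣≈ mulRaw y₁ y₂
      P∤y₁y₂ P∣ with ∣-mul⇒∣⊎∣ y₁ y₂ P∣
      ... | inj₁ P∣y₁ = P∤y₁ (nonzero 0 (s≤s z≤n)) P∣y₁
      ... | inj₂ P∣y₂ = P∤y₂ P∣y₂

    module Factors (h : Pol) where
      N = δ h

      factor : ℕ → Pol
      factor n = h -ₚ decode n

      factor≈ : ∀ n → factor n ≈ sub h (decode n)
      factor≈ n = strip-≈ _

      factor-nonzero : ∀ n → n < N → Nonzero (factor n)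
      factor-nonzero n n<N z = ℕₚ.<-irrefl
        (trans (sym (δ-decode n)) (δ-cong (≈-sym (sub≈[]⇒≈ h (decode n) (≈-trans (≈-sym (factor≈ n)) z))))) n<N

      valuation-factor≤ : ∀ n → n < N → valuation (factor n) ≤ N
      valuation-factor≤ n n<N = ℕₚ.≤-trans (ℕₚ.m≤m*n v d {{ℕ.>-nonZero 1≤d}}) (ℕₚ.≤-trans (ℕₚ.n≤1+n _)
        (ℕₚ.≤-trans (ℕₚ.≤-reflexive (sym (len-pow v)))
        (ℕₚ.≤-trans (len-≤-mul (pow P v) y (λ z → factor-nonzero n n<N (≈-trans equation z)))
        (ℕₚ.≤-trans (ℕₚ.≤-reflexive (sym (len-cong equation))) len-factor≤))))
        where
        open Factorisation (factorise (factor n)) renaming (exponent to v; cofactor to y)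
        len-factor≤ : len (factor n) ≤ N
        len-factor≤ = subst (_≤ N) (sym (len-cong (factor≈ n)))
          (len-sub-≤ h (decode n) N (len≤δ h) (ℕₚ.≤-trans (len-decode-≤ n) (ℕₚ.<⇒≤ n<N)))

      hit : ℕ → ℕ → ℕ
      hit k = ResiduesModulo.Congruent.hit (pow P (suc k)) (suc k * d) (len-pow (suc k)) h

      -- v_P(x) = #{k < N | P^{k+1} ∣ x} as soon as v_P(x) ≤ N
      valuation-factor : ∀ n → n < N → valuation (factor n) ≡ sumTo N (λ k → hit k n)
      valuation-factor n n<N = trans (sym (sumTo-indicator-< v N (valuation-factor≤ n n<N)))
        (sumTo-cong N λ k _ → indicator-cong
          (λ k<v → ∣≈-congʳ (factor≈ n) (proj₂ (pow∣⇔≤ (factor n) v y equation P∤y (suc k)) k<v))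
          (λ P∣ → proj₁ (pow∣⇔≤ (factor n) v y equation P∤y (suc k)) (∣≈-congʳ (≈-sym (factor≈ n)) P∣)) _ _)
        where
        open Factorisation (factorise (factor n)) renaming (exponent to v; cofactor to y)
        P∤y = ∤cofactor (factor-nonzero n n<N)

      valuation-sum : sumTo N (λ n → valuation (factor n)) ≡ legendre N N
      valuation-sum = trans (sumTo-cong N valuation-factor) (trans (sumTo-swap N N (λ n k → hit k n))
        (sumTo-cong N λ k _ → trans (ResiduesModulo.Congruent.hit-count (pow P (suc k)) (suc k * d) (len-pow (suc k)) h)
          (cong (N /q^_) (ℕₚ.*-comm (suc k) d))))

      fact-factorisation : ∃ λ y → (fact h ≈ mulRaw (pow P (legendre N N)) y) × ¬ P ∣≈ y
      fact-factorisation with product-factorisation factor (λ i → i) N factor-nonzero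
      ... | y , e , P∤y = y , ≈-trans e (mul-congˡ y (≈-reflexive (cong (pow P) valuation-sum))) , P∤y

    pow∣fact⇔ : ∀ h e → ((P ^ₚ e) ∣ₚ fact h → e ≤ legendre (δ h) (δ h)) × (e ≤ legendre (δ h) (δ h) → (P ^ₚ e) ∣ₚ fact h)
    pow∣fact⇔ h e =
      (λ P^e∣ → proj₁ bounds (∣≈-congˡ (^ₚ≈pow P e) (∣ₚ⇒∣≈ (P ^ₚ e) (fact h) P^e∣))) ,
      (λ e≤ → ∣≈⇒∣ₚ (P ^ₚ e) (fact h) (∣≈-congˡ (≈-sym (^ₚ≈pow P e)) (proj₂ bounds e≤)))
      where
      open Factors h using (fact-factorisation)
      bounds = pow∣⇔≤ (fact h) (legendre (δ h) (δ h)) (proj₁ fact-factorisation)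
        (proj₁ (proj₂ fact-factorisation)) (proj₂ (proj₂ fact-factorisation)) e

module BaseExpansion {q : ℕ} (F : FiniteField q) (d : ℕ) (1≤d : 1 ≤ d) where
  open Poly F
  open PolynomialEncoding F using (2≤q)
  open LegendreSum q 2≤q d 1≤d public

  _>ᵉ_ : ℕ × ℕ → ℕ × ℕ → Set
  x >ᵉ y = proj₂ y < proj₂ x

  ValidTerm : ℕ × ℕ → Set
  ValidTerm x = 0 < proj₂ x × 1 ≤ proj₁ x × proj₁ x < q ^ d

  b≡repunit : ∀ j → b d j ≡ repunit j
  b≡repunit j = sum-map-applyUpTo (λ i → q ^ (d * i)) (λ i → i) j

  head->ᵉ-all : ∀ {x xs} → Linked _>ᵉ_ (x ∷ xs) → All (x >ᵉ_) xs
  head->ᵉ-all [-] = []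
  head->ᵉ-all (x>y ∷ l) = x>y ∷ All.map (λ lt → ℕₚ.<-trans lt x>y) (head->ᵉ-all l)

  expansion-< : ∀ cs J → Linked _>ᵉ_ cs → All ValidTerm cs → All (λ x → proj₂ x < J) cs → repSum d cs < power J
  expansion-< [] J l v a = power>0 J
  expansion-< ((c , j) ∷ r) J l ((_ , _ , c<base) ∷ v) (j<J ∷ a) =
    ℕₚ.<-≤-trans (ℕₚ.+-monoʳ-< (c * power j) (expansion-< r j (Linked.tail l) v (head->ᵉ-all l)))
      (ℕₚ.≤-trans (ℕₚ.≤-reflexive (ℕₚ.+-comm (c * power j) (power j))) (ℕₚ.≤-trans (ℕₚ.*-monoˡ-≤ (power j) c<base)
        (ℕₚ.≤-trans (ℕₚ.≤-reflexive (sym (power-suc j))) (power-mono-≤ j<J))))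

  power≤expansion : ∀ c j r → All ValidTerm ((c , j) ∷ r) → power j ≤ repSum d ((c , j) ∷ r)
  power≤expansion c j r ((_ , 1≤c , _) ∷ _) =
    ℕₚ.≤-trans (ℕₚ.m≤n*m (power j) c {{ℕ.>-nonZero 1≤c}}) (ℕₚ.m≤m+n _ _)

  expansion>0 : ∀ x cs → All ValidTerm (x ∷ cs) → 1 ≤ repSum d (x ∷ cs)
  expansion>0 (c , j) cs v = ℕₚ.≤-trans (power>0 j) (power≤expansion c j cs v)

  expansion<next-power : ∀ c j r → Linked _>ᵉ_ ((c , j) ∷ r) → All ValidTerm ((c , j) ∷ r) → repSum d ((c , j) ∷ r) < power (suc j)
  expansion<next-power c j r l v = expansion-< ((c , j) ∷ r) (suc j) l v
    (ℕₚ.n<1+n j ∷ All.map (λ lt → ℕₚ.<-trans lt (ℕₚ.n<1+n j)) (head->ᵉ-all l))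

  lastJ>0 : ∀ x cs → All ValidTerm (x ∷ cs) → 1 ≤ lastJ (x ∷ cs)
  lastJ>0 x [] ((j>0 , _) ∷ []) = j>0
  lastJ>0 x (y ∷ r) (_ ∷ v) = lastJ>0 y r v

  exponents-≤ : ∀ cs K → repSum d cs ≤ K → All ValidTerm cs → All (λ x → proj₂ x ≤ K) cs
  exponents-≤ [] K le v = []
  exponents-≤ ((c , j) ∷ r) K le (vc ∷ v) =
    ℕₚ.≤-trans (ℕₚ.<⇒≤ (n<power j)) (ℕₚ.≤-trans (power≤expansion c j r (vc ∷ v)) le)
    ∷ exponents-≤ r K (ℕₚ.≤-trans (ℕₚ.m≤n+m _ _) le) v

  legendre-expansion : ∀ K cs → Linked _>ᵉ_ cs → All ValidTerm cs → All (λ x → proj₂ x ≤ K) cs →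
    legendre K (repSum d cs) ≡ e₀ d cs
  legendre-expansion K [] l v a = legendre-0 K
  legendre-expansion K ((c , j) ∷ r) l ((_ , _ , c<base) ∷ v) (j≤K ∷ a) =
    trans (legendre-digit K c (repSum d r) j c<base (expansion-< r j (Linked.tail l) v (head->ᵉ-all l)) j≤K)
      (cong₂ _+_ (cong (c *_) (sym (b≡repunit j))) (legendre-expansion K r (Linked.tail l) v a))

  -- subtracting 1 turns the lowest term c q^{dj} into (c-1) q^{dj} + (q^{dj} - 1)
  legendre-expansion∸1 : ∀ K x cs → Linked _>ᵉ_ (x ∷ cs) → All ValidTerm (x ∷ cs) → All (λ x → proj₂ x ≤ K) (x ∷ cs) →
    legendre K (repSum d (x ∷ cs) ∸ 1) + lastJ (x ∷ cs) ≡ e₀ d (x ∷ cs)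
  legendre-expansion∸1 K (suc c' , j) [] l ((_ , _ , c<base) ∷ []) (j≤K ∷ []) = begin
    legendre K (repSum d ((suc c' , j) ∷ []) ∸ 1) + j    ≡⟨ cong (λ z → legendre K z + j) split ⟩
    legendre K (c' * power j + p') + j                   ≡⟨ cong (_+ j) (legendre-digit K c' p' j (ℕₚ.<-trans (ℕₚ.n<1+n c') c<base) p'<power j≤K) ⟩
    c' * repunit j + legendre K p' + j                   ≡⟨ ℕₚ.+-assoc (c' * repunit j) _ j ⟩
    c' * repunit j + (legendre K p' + j)                 ≡⟨ cong (c' * repunit j +_) (legendre-power∸1 K j j≤K) ⟩
    c' * repunit j + repunit j                           ≡⟨ ℕₚ.+-comm (c' * repunit j) (repunit j) ⟩
    suc c' * repunit j                                   ≡⟨ cong (suc c' *_) (sym (b≡repunit j)) ⟩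
    suc c' * b d j                                       ≡⟨ sym (ℕₚ.+-identityʳ _) ⟩
    suc c' * b d j + 0 ∎
    where
    open ≡-Reasoning
    p' = power j ∸ 1
    power≡ : power j ≡ suc p'
    power≡ = sym (ℕₚ.m+[n∸m]≡n (power>0 j))
    p'<power : p' < power j
    p'<power = subst (p' <_) (sym power≡) (ℕₚ.n<1+n p')
    split : repSum d ((suc c' , j) ∷ []) ∸ 1 ≡ c' * power j + p'
    split = trans (cong (_∸ 1) (trans (ℕₚ.+-identityʳ _) (cong (λ z → z + c' * z) power≡)))
      (trans (ℕₚ.+-comm p' _) (cong (λ z → c' * z + p') (sym power≡)))
  legendre-expansion∸1 K (c , j) (y ∷ r) l ((_ , _ , c<base) ∷ v) (j≤K ∷ a) = begin
    legendre K (c * power j + S ∸ 1) + lastJ (y ∷ r)            ≡⟨ cong (λ z → legendre K z + lastJ (y ∷ r)) (ℕₚ.+-∸-assoc (c * power j) S>0) ⟩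
    legendre K (c * power j + (S ∸ 1)) + lastJ (y ∷ r)          ≡⟨ cong (_+ lastJ (y ∷ r)) (legendre-digit K c (S ∸ 1) j c<base S∸1<power j≤K) ⟩
    c * repunit j + legendre K (S ∸ 1) + lastJ (y ∷ r)          ≡⟨ ℕₚ.+-assoc (c * repunit j) _ _ ⟩
    c * repunit j + (legendre K (S ∸ 1) + lastJ (y ∷ r))        ≡⟨ cong₂ _+_ (cong (c *_) (sym (b≡repunit j))) (legendre-expansion∸1 K y r (Linked.tail l) v a) ⟩
    c * b d j + e₀ d (y ∷ r) ∎
    where
    open ≡-Reasoning
    S = repSum d (y ∷ r)
    S>0 : 1 ≤ S
    S>0 = expansion>0 y r v
    S∸1<power : S ∸ 1 < power j
    S∸1<power = ℕₚ.≤-<-trans (ℕₚ.m∸n≤m S 1) (expansion-< (y ∷ r) j (Linked.tail l) v (head->ᵉ-all l))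

  linked-snoc : ∀ {xs y} → Linked _>ᵉ_ xs → All (_>ᵉ y) xs → Linked _>ᵉ_ (xs ++ (y ∷ []))
  linked-snoc [] [] = [-]
  linked-snoc [-] (x>y ∷ []) = x>y ∷ [-]
  linked-snoc (x>x' ∷ l) (_ ∷ a) = x>x' ∷ linked-snoc l a

  repSum-++ : ∀ xs ys → repSum d (xs ++ ys) ≡ repSum d xs + repSum d ys
  repSum-++ [] ys = refl
  repSum-++ ((c , j) ∷ xs) ys = trans (cong (c * power j +_) (repSum-++ xs ys)) (sym (ℕₚ.+-assoc (c * power j) _ _))

  -- the base-q^d expansion of m q^{dJ}, most significant digit first
  expansionFuel : ℕ → ℕ → ℕ → List (ℕ × ℕ)
  expansionFuel zero J m = []
  expansionFuel (suc fuel) J m with m % base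
  ... | zero = expansionFuel fuel (suc J) (m / base)
  ... | suc c = expansionFuel fuel (suc J) (m / base) ++ ((suc c , J) ∷ [])

  record ShiftedExpansion (J m : ℕ) (cs : List (ℕ × ℕ)) : Set where
    field
      value : repSum d cs ≡ m * power J
      decreasing : Linked _>ᵉ_ cs
      exponents≥ : All (λ x → J ≤ proj₂ x) cs
      digits : All (λ x → 1 ≤ proj₁ x × proj₁ x < base) cs

  m≤1+f⇒m/base≤f : ∀ f m → m ≤ suc f → m / base ≤ f
  m≤1+f⇒m/base≤f f zero _ = subst (_≤ f) (sym (DivMod.0/n≡0 base)) z≤n
  m≤1+f⇒m/base≤f f (suc m) le = ℕₚ.m<1+n⇒m≤n (ℕₚ.<-≤-trans (DivMod.m/n<m (suc m) base 2≤base) le)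

  expansionFuel-correct : ∀ fuel J m → m ≤ fuel → ShiftedExpansion J m (expansionFuel fuel J m)
  expansionFuel-correct zero J m le with ℕₚ.n≤0⇒n≡0 le
  ... | refl = record { value = refl ; decreasing = [] ; exponents≥ = [] ; digits = [] }
  expansionFuel-correct (suc fuel) J m le with m % base in e
  ... | zero = record
    { value = trans value (trans (cong (m / base *_) (power-suc J))
        (trans (sym (ℕₚ.*-assoc (m / base) base (power J))) (cong (_* power J) (sym m≡))))
    ; decreasing = decreasing
    ; exponents≥ = All.map (ℕₚ.≤-trans (ℕₚ.n≤1+n J)) exponents≥
    ; digits = digits }
    where
    open ShiftedExpansion (expansionFuel-correct fuel (suc J) (m / base) (m≤1+f⇒m/base≤f fuel m le))
    m≡ : m ≡ m / base * base
    m≡ = trans (DivMod.m≡m%n+[m/n]*n m base) (cong (_+ m / base * base) e)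
  ... | suc c = record
    { value = trans (repSum-++ (expansionFuel fuel (suc J) (m / base)) _)
        (trans (cong₂ _+_ value (ℕₚ.+-identityʳ _)) value≡)
    ; decreasing = linked-snoc decreasing exponents≥
    ; exponents≥ = Allₚ.++⁺ (All.map (ℕₚ.≤-trans (ℕₚ.n≤1+n J)) exponents≥) (ℕₚ.≤-refl ∷ [])
    ; digits = Allₚ.++⁺ digits ((s≤s z≤n , subst (_< base) e (DivMod.m%n<n m base)) ∷ []) }
    where
    open ShiftedExpansion (expansionFuel-correct fuel (suc J) (m / base) (m≤1+f⇒m/base≤f fuel m le))
    m≡ : m ≡ suc c + m / base * base
    m≡ = trans (DivMod.m≡m%n+[m/n]*n m base) (cong (_+ m / base * base) e)
    value≡ : m / base * power (suc J) + suc c * power J ≡ m * power J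
    value≡ = trans (cong (λ z → m / base * z + suc c * power J) (power-suc J))
      (trans (rearrange (m / base) base (power J) (suc c)) (cong (_* power J) (sym m≡)))
      where
      open +-*-Solver
      rearrange : ∀ a b p c → a * (b * p) + c * p ≡ (c + a * b) * p
      rearrange = solve 4 (λ a b p c → a :* (b :* p) :+ c :* p := (c :+ a :* b) :* p) refl

  expansion-exists : ∀ n → base ∣ n → ∃ λ cs → IsRep d n cs
  expansion-exists n base∣n = cs ,
    trans value (trans (cong (n / base *_) power-1) (trans (ℕₚ.*-comm (n / base) base) (DivMod.m*[n/m]≡n base∣n))) ,
    decreasing , All.zipWith (λ { (1≤j , digit) → 1≤j , digit }) (exponents≥ , digits)
    where
    cs = expansionFuel (n / base) 1 (n / base)
    open ShiftedExpansion (expansionFuel-correct (n / base) 1 (n / base) ℕₚ.≤-refl)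

  expansion-unique : ∀ cs cs' → Linked _>ᵉ_ cs → All ValidTerm cs → Linked _>ᵉ_ cs' → All ValidTerm cs' →
    repSum d cs ≡ repSum d cs' → cs ≡ cs'
  expansion-unique [] [] _ _ _ _ _ = refl
  expansion-unique [] (x ∷ r) _ _ _ v' e = ⊥-elim (ℕₚ.<-irrefl e (expansion>0 x r v'))
  expansion-unique (x ∷ r) [] _ v _ _ e = ⊥-elim (ℕₚ.<-irrefl (sym e) (expansion>0 x r v))
  expansion-unique ((c , j) ∷ r) ((c' , j') ∷ r') l v l' v' e with ℕₚ.<-cmp j j'
  ... | tri< j<j' _ _ = ⊥-elim (ℕₚ.<-irrefl refl (ℕₚ.<-≤-trans (expansion<next-power c j r l v)
    (ℕₚ.≤-trans (power-mono-≤ j<j') (ℕₚ.≤-trans (power≤expansion c' j' r' v') (ℕₚ.≤-reflexive (sym e))))))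
  ... | tri> _ _ j>j' = ⊥-elim (ℕₚ.<-irrefl refl (ℕₚ.<-≤-trans (expansion<next-power c' j' r' l' v')
    (ℕₚ.≤-trans (power-mono-≤ j>j') (ℕₚ.≤-trans (power≤expansion c j r v) (ℕₚ.≤-reflexive e)))))
  ... | tri≈ _ refl _ = cong₂ _∷_ (cong (_, j) c≡c')
    (expansion-unique r r' (Linked.tail l) (All.tail v) (Linked.tail l') (All.tail v') rest≡)
    where
    leading-digit : ∀ c₀ rest → rest < power j → (c₀ * power j + rest) / power j ≡ c₀
    leading-digit c₀ rest rest< = trans ([a*power+r]/power c₀ rest j)
      (trans (cong (c₀ +_) (<power⇒/≡0 j rest<)) (ℕₚ.+-identityʳ c₀))
    c≡c' : c ≡ c'
    c≡c' = trans (sym (leading-digit c (repSum d r) (expansion-< r j (Linked.tail l) (All.tail v) (head->ᵉ-all l))))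
      (trans (cong (_/ power j) e) (leading-digit c' (repSum d r') (expansion-< r' j (Linked.tail l') (All.tail v') (head->ᵉ-all l'))))
    rest≡ : repSum d r ≡ repSum d r'
    rest≡ = ℕₚ.+-cancelˡ-≡ (c * power j) _ _ (trans e (cong (λ z → z * power j + repSum d r') (sym c≡c')))

module SmarandacheInverse {q : ℕ} (F : FiniteField q) (f : Poly.Pol F) (nf : Poly.Normalized F f) (f≢[] : f ≢ []) where
  open FactorialValuation F

  N N' : ℕ
  N = δ f
  N' = N ∸ 1

  N≡1+N' : N ≡ suc N'
  N≡1+N' = sym (ℕₚ.m+[n∸m]≡n (ℕₚ.n≢0⇒n>0 N≢0))
    where
    N≢0 : N ≢ 0
    N≢0 N≡0 = f≢[] (trans (sym nf) (≈⇒strip≡ f [] (δ-injective N≡0)))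

  module Window (P : Pol) (irr : Irreducible P) where
    open LegendreFormula P irr
    open LegendreSum q 2≤q d 1≤d using (legendre-extend; legendre-mono-≤; legendre-∸1)

    T : ℕ → ℕ
    T n = legendre n n

    T-below : ∀ m → m < N → T m ≤ T N'
    T-below m m<N = ℕₚ.≤-trans (ℕₚ.≤-reflexive (sym (legendre-extend N' m m≤N'))) (legendre-mono-≤ N' m≤N')
      where
      m≤N' : m ≤ N'
      m≤N' = ℕₚ.m<1+n⇒m≤n (subst (m <_) N≡1+N' m<N)

    P^e≢[] : ∀ e → (P ^ₚ e) ≢ []
    P^e≢[] e z = pow-nonzero e (≈-trans (≈-sym (^ₚ≈pow P e)) (≈-reflexive z))

    -- minimality: T is monotone, so every h' with δ h' < N has v_P(h'!) ≤ T(N - 1) < e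
    window⇒S : ∀ e → T N' < e → e ≤ T N → SIs (P ^ₚ e) f
    window⇒S e T[N']<e e≤T[N] = inj₂ (P^e≢[] e , nf , proj₂ (pow∣fact⇔ f e) e≤T[N] ,
      λ h' _ δh'<N P^e∣ → ℕₚ.<-irrefl refl
        (ℕₚ.<-≤-trans T[N']<e (ℕₚ.≤-trans (proj₁ (pow∣fact⇔ h' e) P^e∣) (T-below (δ h') δh'<N))))

    -- the polynomial with code N - 1 witnesses the lower bound
    S⇒window : ∀ e → SIs (P ^ₚ e) f → T N' < e × e ≤ T N
    S⇒window e (inj₁ (_ , f≡[])) = ⊥-elim (f≢[] f≡[])
    S⇒window e (inj₂ (_ , _ , P^e∣f! , minimal)) = T[N']<e , proj₁ (pow∣fact⇔ f e) P^e∣f!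
      where
      h' = strip (decode N')
      δh'≡N' : δ h' ≡ N'
      δh'≡N' = trans (δ-cong (strip-≈ (decode N'))) (δ-decode N')
      T[N']<e : T N' < e
      T[N']<e with e ≤? T N'
      ... | no e≰ = ℕₚ.≰⇒> e≰
      ... | yes e≤ = ⊥-elim (minimal h' (strip-idem (decode N'))
        (subst (_< N) (sym δh'≡N') (subst (N' <_) (sym N≡1+N') (ℕₚ.n<1+n N')))
        (proj₂ (pow∣fact⇔ h' e) (subst (λ z → e ≤ T z) (sym δh'≡N') e≤)))

    ¬q^d∣N⇒¬S : ∀ e → ¬ (q ^ d ∣ N) → ¬ SIs (P ^ₚ e) f
    ¬q^d∣N⇒¬S e q^d∤N S with S⇒window e S
    ... | T[N']<e , e≤T[N] = ℕₚ.<-irrefl refl (ℕₚ.<-≤-trans T[N']<e (subst (e ≤_) T[N]≡T[N'] e≤T[N]))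
      where
      T[N]≡T[N'] : T N ≡ T N'
      T[N]≡T[N'] = trans (sym (legendre-∸1 N N q^d∤N)) (legendre-extend N N' (ℕₚ.m∸n≤m N 1))

  m+n∸[n∸1] : ∀ m n o → m + n ≡ o → 1 ≤ n → o ∸ (n ∸ 1) ≡ suc m
  m+n∸[n∸1] m (suc n) o m+n≡o _ =
    trans (cong (_∸ n) (trans (sym m+n≡o) (ℕₚ.+-suc m n))) (ℕₚ.m+n∸n≡m (suc m) n)

  module Expansion (d : ℕ) (1≤d : 1 ≤ d) where
    open BaseExpansion F d 1≤d

    legendre-at-expansion : ∀ cs → IsRep d N cs →
      legendre N N ≡ e₀ d cs × e₀ d cs ∸ (lastJ cs ∸ 1) ≡ suc (legendre N' N')
    legendre-at-expansion [] (N≡0 , _) = ⊥-elim (ℕₚ.1+n≢0 (trans (sym N≡1+N') (sym N≡0)))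
    legendre-at-expansion (x ∷ r) (value , decreasing , valid) =
      trans (cong (legendre N) (sym value)) (legendre-expansion N (x ∷ r) decreasing valid exponents≤N) ,
      m+n∸[n∸1] _ _ _ (trans (cong (_+ lastJ (x ∷ r))
        (trans (sym (legendre-extend N N' (ℕₚ.m∸n≤m N 1))) (cong (λ z → legendre N (z ∸ 1)) (sym value))))
        (legendre-expansion∸1 N x r decreasing valid exponents≤N)) (lastJ>0 x r valid)
      where
      exponents≤N = exponents-≤ (x ∷ r) N (ℕₚ.≤-reflexive value) valid

  inverse-image : ∀ d cs → IsRep d N cs → ∀ P → Irreducible P → deg P ≡ d →
    ∀ e → e₀ d cs ∸ (lastJ cs ∸ 1) ≤ e → e ≤ e₀ d cs → SIs (P ^ₚ e) f
  inverse-image .(deg P) cs rep P irr refl e lower upper with Expansion.legendre-at-expansion (deg P) (proj₁ (proj₂ irr)) cs rep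
  ... | T[N]≡e₀ , e₀-window≡ = Window.window⇒S P irr e (subst (_≤ e) e₀-window≡ lower) (subst (e ≤_) (sym T[N]≡e₀) upper)

  inverse-image-complete : (P : Pol) (e : ℕ) → Irreducible P → SIs (P ^ₚ e) f →
    ∃ λ d → 1 ≤ d × q ^ d ∣ N × deg P ≡ d × ∃ λ cs → IsRep d N cs × e₀ d cs ∸ (lastJ cs ∸ 1) ≤ e × e ≤ e₀ d cs
  inverse-image-complete P e irr S with q ^ deg P ∣? N
  ... | no q^d∤N = ⊥-elim (Window.¬q^d∣N⇒¬S P irr e q^d∤N S)
  ... | yes q^d∣N with BaseExpansion.expansion-exists F (deg P) 1≤d N q^d∣N
    where 1≤d = proj₁ (proj₂ irr)
  ...   | cs , rep with Expansion.legendre-at-expansion (deg P) (proj₁ (proj₂ irr)) cs rep | Window.S⇒window P irr e S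
  ...     | T[N]≡e₀ , e₀-window≡ | T[N']<e , e≤T[N] =
    deg P , proj₁ (proj₂ irr) , q^d∣N , refl , cs , rep , subst (_≤ e) (sym e₀-window≡) T[N']<e , subst (e ≤_) T[N]≡e₀ e≤T[N]

proposition3p9 : (q : ℕ) (F : FiniteField q) →
    let open Poly F in
    (f : Pol) → Normalized f → f ≢ [] → (∃ λ r → f ≡ 0# ∷ r) →
    ((d : ℕ) → 1 ≤ d → q ^ d ∣ δ f →
      (∃ λ cs → IsRep d (δ f) cs) ×
      (∀ cs cs' → IsRep d (δ f) cs → IsRep d (δ f) cs' → cs ≡ cs') ×
      (∀ cs → IsRep d (δ f) cs →
        ∀ P → Irreducible P → deg P ≡ d →
        ∀ e → e₀ d cs ∸ (lastJ cs ∸ 1) ≤ e → e ≤ e₀ d cs →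
        SIs (P ^ₚ e) f))
    ×
    ((P : Pol) (e : ℕ) → Irreducible P → 1 ≤ e → SIs (P ^ₚ e) f →
      ∃ λ d → 1 ≤ d × q ^ d ∣ δ f × deg P ≡ d ×
        ∃ λ cs → IsRep d (δ f) cs ×
          e₀ d cs ∸ (lastJ cs ∸ 1) ≤ e × e ≤ e₀ d cs)
proposition3p9 q F f nf f≢[] _ =
  (λ d 1≤d q^d∣δf →
    let open BaseExpansion F d 1≤d in
    expansion-exists N q^d∣δf ,
    (λ { cs cs' (v , l , a) (v' , l' , a') → expansion-unique cs cs' l a l' a' (trans v (sym v')) }) ,
    (λ cs rep → inverse-image d cs rep)) ,
  (λ P e irr _ → inverse-image-complete P e irr)
  where open SmarandacheInverse F f nf f≢[]
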